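{- Given $k\ge2$, $\alpha,\beta,\mu>0$ and an odd integer $\ell\ge3$, set $\vartheta=\min\{\frac\alpha4,\frac{\beta}{2\ell}\}$ and let $\Psi$ be a $k$-uniform $(\alpha,\beta,\ell,\mu)$-constellation on $n\ge6k$ vertices. If $S,X\subseteq V(\Psi)$ are disjoint, $|S|\le k-2$ and $|X|\le\vartheta n$, then $\Psi_S-X$ is a $(k-|S|)$-uniform $\big(\frac\alpha2,\frac\beta2,\ell,2\mu\big)$-constellation.
   Context: A $k$-uniform hypergraph is $H=(V,E)$ with $E$ a set of $k$-element subsets of $V$; $d_H(S)=|\{e\in E:S\subseteq e\}|$, $\delta_i(H)=\min\{d_H(S):|S|=i\}$. For $|S|\le k-2$, $\overline H_S$ is the hypergraph on $V\setminus S$ with edges $\{e\setminus S:S\subseteq e\in E\}$, $H_S$ has the same edges on $V$. A $k$-uniform constellation is $\Psi=(H,\{R_x:x\in V(H)^{(k-2)}\})$ with $H$ $k$-uniform and each $R_x$ an induced subgraph of the graph $H_x$ (for $k=2$ only $R_\emptyset\subseteq H$); $H(\Psi)=H$, $V(\Psi)=V(H)$. For $|S|\le k-2$, $\Psi_S=(\overline H_S,\{R_{x\cup S}-S:x\in(V(H)\setminus S)^{(k-2-|S|)}\})$. For $Y\subseteq V(\Psi)$, $\Psi[Y]=(H[Y],\{R_x[Y]:x\in Y^{(k-2)}\})$ and $\Psi-X=\Psi[V(\Psi)\setminus X]$. $\Psi$ is an $(\alpha,\mu)$-constellation if $\delta_{k-2}(H)\ge(\frac59+\alpha)\frac{|V(\Psi)|^2}2$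 and every $x\in V(\Psi)^{(k-2)}$ has $|V(R_x)|\ge(\frac23+\frac\alpha2)|V(\Psi)|$ and at most $\mu|V(\Psi)|^2$ edges of the graph $H(\Psi_x)$ between $V(R_x)$ and $V(\Psi)\setminus V(R_x)$. It is an $(\alpha,\beta,\ell,\mu)$-constellation if moreover for every $x$ and all distinct $y,z\in V(R_x)$ the number of $y$-$z$-paths of length $\ell$ in $R_x$ is at least $\beta|V(\Psi)|^{\ell-1}$. -}

module Defs where

open import Data.Nat as ℕ using (ℕ; zero; suc; _+_; _*_; _∸_)
open import Data.Bool using (Bool; true; false; _∧_; _∨_; not; T; if_then_else_)
open import Data.Fin using (Fin; _≟_)
open import Data.Fin.Subset using (Subset; _⊆_; _∩_; _∪_; _─_; ∣_∣; ⁅_⁆)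
open import Data.Fin.Subset.Properties using (_⊆?_)
open import Data.Vec as Vec using (Vec; []; _∷_; lookup)
open import Data.List as List using (List; []; _∷_; concatMap; length; filter)
open import Data.Product using (_×_)
open import Data.Integer using (+_)
open import Data.Rational as ℚ using (ℚ; _/_; 0ℚ; ½; _⊓_)
open import Relation.Nullary using (does)
open import Relation.Binary.PropositionalEquality using (_≡_)

allVecs : {A : Set} → List A → (n : ℕ) → List (Vec A n)
allVecs xs zero    = [] ∷ []
allVecs xs (suc n) = concatMap (λ v → List.map (λ a → a ∷ v) xs) (allVecs xs n)

allSubsets : (m : ℕ) → List (Subset m)
allSubsets m = allVecs (true ∷ false ∷ []) m

count : {A : Set} → (A → Bool) → List A → ℕ
count p xs = length (filter (λ a → Data.Bool._≟_ (p a) true) xs)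
  where import Data.Bool

_∈ᵇ_ : {m : ℕ} → Fin m → Subset m → Bool
i ∈ᵇ s = lookup s i

_⊆ᵇ_ : {m : ℕ} → Subset m → Subset m → Bool
s ⊆ᵇ t = does (s ⊆? t)

_==ᵇ_ : ℕ → ℕ → Bool
a ==ᵇ b = does (a ℕ.≟ b)

_≠ᶠ_ : {m : ℕ} → Fin m → Fin m → Bool
a ≠ᶠ b = not (does (a ≟ b))

disjᵇ : {m : ℕ} → Subset m → Subset m → Bool
disjᵇ s t = ∣ s ∩ t ∣ ==ᵇ 0

-- V  : the vertex set V(H) (a subset of Fin m)
-- E  : characteristic function of the edge set of H
-- R  : R x is the vertex set of the graph R_x; R_x is the induced
--      subgraph of H_x on this vertex set (only x ∈ V^(k-2) matter)

record Constellation (m : ℕ) : Set where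
  constructor mkConstellation
  field
    V : Subset m
    E : Subset m → Bool
    R : Subset m → Subset m
open Constellation public

IsUniformConstellation : {m : ℕ} → ℕ → Constellation m → Set
IsUniformConstellation {m} k Ψ =
  ((e : Subset m) → T (E Ψ e) → (e ⊆ V Ψ) × (∣ e ∣ ≡ k)) ×
  ((x : Subset m) → x ⊆ V Ψ → ∣ x ∣ ≡ k ∸ 2 → R Ψ x ⊆ V Ψ)

-- Ψ_S : vertex set V ∖ S, edges e ∖ S for S ⊆ e ∈ E, and R'_x = R_{x ∪ S} - S
linkC : {m : ℕ} → Subset m → Constellation m → Constellation m
linkC S Ψ = mkConstellation (V Ψ ─ S)
                            (λ f → (f ⊆ᵇ (V Ψ ─ S)) ∧ E Ψ (f ∪ S))
                            (λ x → R Ψ (x ∪ S) ─ S)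

inducedC : {m : ℕ} → Subset m → Constellation m → Constellation m
inducedC Y Ψ = mkConstellation (V Ψ ∩ Y)
                               (λ e → E Ψ e ∧ (e ⊆ᵇ Y))
                               (λ x → R Ψ x ∩ Y)

deleteC : {m : ℕ} → Subset m → Constellation m → Constellation m
deleteC X Ψ = inducedC (V Ψ ─ X) Ψ

degree : {m : ℕ} → Constellation m → Subset m → ℕ
degree {m} Ψ x = count (λ e → E Ψ e ∧ (x ⊆ᵇ e)) (allSubsets m)

adjLink : {m : ℕ} → Constellation m → Subset m → Fin m → Fin m → Bool
adjLink Ψ x u v = (u ≠ᶠ v) ∧ not (u ∈ᵇ x) ∧ not (v ∈ᵇ x)
                  ∧ E Ψ (x ∪ (⁅ u ⁆ ∪ ⁅ v ⁆))

adjR : {m : ℕ} → Constellation m → Subset m → Fin m → Fin m → Bool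
adjR Ψ x u v = (u ∈ᵇ R Ψ x) ∧ (v ∈ᵇ R Ψ x) ∧ adjLink Ψ x u v

-- number of edges of the graph H(Ψ_x) between V(R_x) and V(Ψ) ∖ V(R_x):
-- 2-sets f disjoint from x with f ∪ x ∈ E and exactly one vertex in R x
crossEdges : {m : ℕ} → Constellation m → Subset m → ℕ
crossEdges {m} Ψ x =
  count (λ f → (∣ f ∣ ==ᵇ 2) ∧ disjᵇ f x ∧ E Ψ (f ∪ x) ∧ (∣ f ∩ R Ψ x ∣ ==ᵇ 1))
        (allSubsets m)

allDistinct : {m n : ℕ} → Vec (Fin m) n → Bool
allDistinct []       = true
allDistinct (a ∷ as) = Vec.foldr _ (λ b r → (a ≠ᶠ b) ∧ r) true as ∧ allDistinct as

consecutive : {m n : ℕ} → (Fin m → Fin m → Bool) → Vec (Fin m) n → Bool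
consecutive adj []           = true
consecutive adj (a ∷ [])     = true
consecutive adj (a ∷ b ∷ as) = adj a b ∧ consecutive adj (b ∷ as)

isPath : {m : ℕ} → (Fin m → Fin m → Bool) → (ℓ : ℕ) → Fin m → Fin m →
         Vec (Fin m) (suc ℓ) → Bool
isPath adj ℓ y z w = does (Vec.head w ≟ y) ∧ does (Vec.last w ≟ z)
                     ∧ allDistinct w ∧ consecutive adj w

pathCount : {m : ℕ} → Constellation m → Subset m → (ℓ : ℕ) → Fin m → Fin m → ℕ
pathCount {m} Ψ x ℓ y z =
  count (isPath (adjR Ψ x) ℓ y z) (allVecs (List.allFin m) (suc ℓ))

toℚ : ℕ → ℚ
toℚ n = + n / 1

fiveNinths twoThirds : ℚ
fiveNinths = + 5 / 9
twoThirds  = + 2 / 3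

IsAMConstellation : {m : ℕ} → ℕ → ℚ → ℚ → Constellation m → Set
IsAMConstellation {m} k α μ Ψ =
  ((x : Subset m) → x ⊆ V Ψ → ∣ x ∣ ≡ k ∸ 2 →
     (fiveNinths ℚ.+ α) ℚ.* toℚ (n * n) ℚ.* ½ ℚ.≤ toℚ (degree Ψ x)) ×
  ((x : Subset m) → x ⊆ V Ψ → ∣ x ∣ ≡ k ∸ 2 →
     ((twoThirds ℚ.+ α ℚ.* ½) ℚ.* toℚ n ℚ.≤ toℚ ∣ R Ψ x ∣) ×
     (toℚ (crossEdges Ψ x) ℚ.≤ μ ℚ.* toℚ (n * n)))
  where n = ∣ V Ψ ∣

IsABLMConstellation : {m : ℕ} → ℕ → ℚ → ℚ → ℕ → ℚ → Constellation m → Set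
IsABLMConstellation {m} k α β ℓ μ Ψ =
  IsUniformConstellation k Ψ ×
  IsAMConstellation k α μ Ψ ×
  ((x : Subset m) → x ⊆ V Ψ → ∣ x ∣ ≡ k ∸ 2 →
   (y z : Fin m) → y Data.Fin.Subset.∈ R Ψ x → z Data.Fin.Subset.∈ R Ψ x → y ≢ z →
     β ℚ.* toℚ (n ℕ.^ (ℓ ∸ 1)) ℚ.≤ toℚ (pathCount Ψ x ℓ y z))
  where n = ∣ V Ψ ∣
        open import Relation.Binary.PropositionalEquality using (_≢_)

-- ϑ = min{α/4, β/(2ℓ)}  (for ℓ ≥ 1; the value for ℓ = 0 is irrelevant)
divℕ : ℚ → ℕ → ℚ
divℕ q zero    = 0ℚ
divℕ q (suc d) = q ℚ.* (+ 1 / suc d)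

ϑ : ℚ → ℚ → ℕ → ℚ
ϑ α β ℓ = divℕ α 4 ⊓ divℕ β (2 * ℓ)

-- Write u = x ∪ S for a root x of Ψ_S - X: the link of x in Ψ_S - X is the link of u in Ψ
-- with the vertices of S ∪ X removed, and R_u already avoids S because no path of R_u can start
-- in u.  Deleting the t ≤ ϑn vertices of X costs at most tn ≤ αn²/4 pairs of the link, at most
-- t ≤ αn/4 vertices of R_u, and, counting vertex sequences by the first place where they meet X,
-- at most (ℓ - 1)tn^(ℓ-2) ≤ βn^(ℓ-1)/2 paths of length ℓ; no crossing edges appear.  The
-- codegree condition forces α < 4/9, hence t ≤ n/9, and with |S| ≤ k ≤ n/6 the new vertex set
-- keeps at least 13n/18 vertices, so n² ≤ 2n′²; this turns the counts into the halved parameters.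

module Submission where

open import Defs
open import Data.Nat using (ℕ; _≤_; _*_; _∸_)
open import Data.Nat.Divisibility using () renaming (_∣_ to _divides_)
open import Data.Fin.Subset using (Subset; _⊆_; _∩_; ∣_∣; Empty)
open import Data.Rational as ℚ using (ℚ; Positive; ½)
open import Data.Product using (_×_)
open import Relation.Nullary using (¬_)

open import Data.Nat using (zero; suc; _+_; _^_; z≤n; s≤s; >-nonZero)
open import Data.Nat.Properties as ℕₚ
  using (≤-refl; ≤-trans; ≤-reflexive; +-mono-≤; +-monoˡ-≤; +-monoʳ-≤; *-mono-≤; *-monoˡ-≤; *-monoʳ-≤; module ≤-Reasoning)
open import Data.Bool using (Bool; true; false; _∧_; _∨_; not; T)
open import Data.Bool.Properties using (∧-zeroʳ; ∧-identityʳ)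
open import Data.Fin as Fin using (Fin; _≟_)
import Data.Fin.Properties as Finₚ
open import Data.Fin.Subset using (_∪_; _─_; ⁅_⁆; _∈_; _∉_; Nonempty)
open import Data.Fin.Subset.Properties
  using (_⊆?_; _∈?_; x∈p∩q⁺; x∈p∩q⁻; x∈p∪q⁺; x∈p∪q⁻; x∈p∧x∉q⇒x∈p─q; x∈⁅x⁆; x∈⁅y⁆⇒x≡y;
         p⊆q⇒∣p∣≤∣q∣; ∣p∩q∣≤∣q∣; Empty-unique; ∣⊥∣≡0; ∣⁅x⁆∣≡1; ⊆-antisym; ∪-assoc; ∪-comm)
open import Data.Vec as Vec using (Vec; []; _∷_; lookup; here; there)
open import Data.Vec.Relation.Unary.All as All using (All; []; _∷_)
open import Data.Vec.Properties using ([]=⇒lookup; lookup⇒[]=; lookup-zipWith)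
open import Data.List as List using (List; []; _∷_; _++_; concatMap; allFin)
open import Data.List.Properties using (filter-++; length-++)
import Data.Bool as Bool
open import Data.Nat.Tactic.RingSolver using (solve-∀)
open import Data.Rational using (mkℚ; 0ℚ; 1ℚ; _-_)
import Data.Rational.Properties as ℚₚ
import Data.Integer as ℤ
import Data.Integer.Properties as ℤₚ
import Data.Nat.Coprimality as Coprime
open import Tactic.RingSolver using () renaming (solve-∀ to solve-∀-ring)
import Tactic.RingSolver.Core.AlmostCommutativeRing as ACR
open import Relation.Nullary.Decidable using (dec⇒maybe)
open import Algebra.Properties.CommutativeSemigroup ℕₚ.+-commutativeSemigroup
  using () renaming (interchange to +-interchange)
open import Data.Product using (_,_; proj₁; proj₂; ∃-syntax)
open import Data.Sum using (_⊎_; inj₁; inj₂; [_,_])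
open import Data.Unit using (tt)
open import Data.Empty using (⊥-elim)
open import Function using (_∘_)
open import Relation.Nullary using (Dec; does; _because_; yes; no; contradiction)
open import Relation.Nullary.Reflects using (invert)
open import Relation.Binary.PropositionalEquality
  using (_≡_; _≢_; refl; sym; trans; cong; cong₂; subst; subst₂; module ≡-Reasoning)

does⇒ : ∀ {A : Set} {d : Dec A} → T (does d) → A
does⇒ {d = true because [a]} _ = invert [a]

⇒does : ∀ {A : Set} {d : Dec A} → A → T (does d)
⇒does {d = true because _} _ = tt
⇒does {d = false because [¬a]} a = invert [¬a] a

T-∧⁻ : ∀ {a b} → T (a ∧ b) → T a × T b
T-∧⁻ {true} t = tt , t

T-∧⁺ : ∀ {a b} → T a → T b → T (a ∧ b)
T-∧⁺ {true} _ t = t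

T-∨⁻ : ∀ {a b} → T (a ∨ b) → T a ⊎ T b
T-∨⁻ {true} _ = inj₁ tt
T-∨⁻ {false} t = inj₂ t

T-∨⁺ˡ : ∀ {a b} → T a → T (a ∨ b)
T-∨⁺ˡ {true} _ = tt

T-∨⁺ʳ : ∀ {a b} → T b → T (a ∨ b)
T-∨⁺ʳ {true} _ = tt
T-∨⁺ʳ {false} t = t

T-not⁻ : ∀ {b} → T (not b) → ¬ T b
T-not⁻ {false} _ ()

T-not⁺ : ∀ {b} → ¬ T b → T (not b)
T-not⁺ {true} ¬b = ¬b tt
T-not⁺ {false} _ = tt

T-injective : ∀ {a b} → (T a → T b) → (T b → T a) → a ≡ b
T-injective {false} {false} _ _ = refl
T-injective {false} {true} _ g = ⊥-elim (g tt)
T-injective {true} {false} f _ = ⊥-elim (f tt)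
T-injective {true} {true} _ _ = refl

module _ {m : ℕ} where

  ∈ᵇ⇒∈ : ∀ {i : Fin m} {p : Subset m} → T (i ∈ᵇ p) → i ∈ p
  ∈ᵇ⇒∈ {i} {p} t with lookup p i in eq
  ... | true = lookup⇒[]= i p eq

  ∈⇒∈ᵇ : ∀ {i : Fin m} {p : Subset m} → i ∈ p → T (i ∈ᵇ p)
  ∈⇒∈ᵇ i∈p = subst T (sym ([]=⇒lookup i∈p)) tt

  ⊆ᵇ⇒⊆ : ∀ {p q : Subset m} → T (p ⊆ᵇ q) → p ⊆ q
  ⊆ᵇ⇒⊆ {p} {q} = does⇒ {d = p ⊆? q}

  ⊆⇒⊆ᵇ : ∀ {p q : Subset m} → p ⊆ q → T (p ⊆ᵇ q)
  ⊆⇒⊆ᵇ {p} {q} = ⇒does {d = p ⊆? q}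

  ≠ᶠ⇒≢ : ∀ {i j : Fin m} → T (i ≠ᶠ j) → i ≢ j
  ≠ᶠ⇒≢ {i} {j} t with i ≟ j
  ... | no i≢j = i≢j

  ≢⇒≠ᶠ : ∀ {i j : Fin m} → i ≢ j → T (i ≠ᶠ j)
  ≢⇒≠ᶠ {i} {j} i≢j with i ≟ j
  ... | yes i≡j = i≢j i≡j
  ... | no _ = tt

==ᵇ⇒≡ : ∀ {a b : ℕ} → T (a ==ᵇ b) → a ≡ b
==ᵇ⇒≡ {a} {b} = ℕₚ.≡ᵇ⇒≡ a b

≡⇒==ᵇ : ∀ {a b : ℕ} → a ≡ b → T (a ==ᵇ b)
≡⇒==ᵇ {a} {b} = ℕₚ.≡⇒≡ᵇ a b

private
  variable
    n : ℕ
    A B : Set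

Disjoint : Subset n → Subset n → Set
Disjoint p q = ∀ {i} → i ∈ p → i ∉ q

x∈p─q⁻ : ∀ {i : Fin n} (p q : Subset n) → i ∈ p ─ q → i ∈ p × i ∉ q
x∈p─q⁻ (_ ∷ p) (_ ∷ q) (there i∈p─q) with x∈p─q⁻ p q i∈p─q
... | i∈p , i∉q = there i∈p , λ { (there i∈q) → i∉q i∈q }
x∈p─q⁻ (true ∷ p) (false ∷ q) here = here , λ ()
x∈p─q⁻ {i = Fin.zero} (true ∷ p) (true ∷ q) ()
x∈p─q⁻ {i = Fin.zero} (false ∷ p) (true ∷ q) ()
x∈p─q⁻ {i = Fin.zero} (false ∷ p) (false ∷ q) ()

Empty⇒Disjoint : ∀ {p q : Subset n} → Empty (p ∩ q) → Disjoint p q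
Empty⇒Disjoint p∩q=∅ i∈p i∈q = p∩q=∅ (_ , x∈p∩q⁺ (i∈p , i∈q))

Disjoint-tail : ∀ {a b} {p q : Subset n} → Disjoint (a ∷ p) (b ∷ q) → Disjoint p q
Disjoint-tail p#q i∈p i∈q = p#q (there i∈p) (there i∈q)

∣p∣≡0⇒Empty : ∀ {p : Subset n} → ∣ p ∣ ≡ 0 → Empty p
∣p∣≡0⇒Empty {p = true ∷ p} ()
∣p∣≡0⇒Empty {p = false ∷ p} ∣p∣≡0 (_ , there i∈p) = ∣p∣≡0⇒Empty ∣p∣≡0 (_ , i∈p)

disjᵇ⇒Disjoint : ∀ {p q : Subset n} → T (disjᵇ p q) → Disjoint p q
disjᵇ⇒Disjoint t = Empty⇒Disjoint (∣p∣≡0⇒Empty (==ᵇ⇒≡ t))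

Disjoint⇒disjᵇ : ∀ {p q : Subset n} → Disjoint p q → T (disjᵇ p q)
Disjoint⇒disjᵇ {n} {p} {q} p#q = ≡⇒==ᵇ (trans (cong ∣_∣ (Empty-unique p∩q=∅)) (∣⊥∣≡0 n))
  where
  p∩q=∅ : Empty (p ∩ q)
  p∩q=∅ (_ , i∈p∩q) = let i∈p , i∈q = x∈p∩q⁻ p q i∈p∩q in p#q i∈p i∈q

∣p∪q∣≤∣p∣+∣q∣ : ∀ (p q : Subset n) → ∣ p ∪ q ∣ ≤ ∣ p ∣ + ∣ q ∣
∣p∪q∣≤∣p∣+∣q∣ [] [] = z≤n
∣p∪q∣≤∣p∣+∣q∣ (true ∷ p) (true ∷ q) = s≤s (≤-trans (∣p∪q∣≤∣p∣+∣q∣ p q) (+-monoʳ-≤ ∣ p ∣ (ℕₚ.n≤1+n ∣ q ∣)))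
∣p∪q∣≤∣p∣+∣q∣ (true ∷ p) (false ∷ q) = s≤s (∣p∪q∣≤∣p∣+∣q∣ p q)
∣p∪q∣≤∣p∣+∣q∣ (false ∷ p) (true ∷ q) = ≤-trans (s≤s (∣p∪q∣≤∣p∣+∣q∣ p q)) (≤-reflexive (sym (ℕₚ.+-suc ∣ p ∣ ∣ q ∣)))
∣p∪q∣≤∣p∣+∣q∣ (false ∷ p) (false ∷ q) = ∣p∪q∣≤∣p∣+∣q∣ p q

∣p∪q∣≡∣p∣+∣q∣ : ∀ (p q : Subset n) → Disjoint p q → ∣ p ∪ q ∣ ≡ ∣ p ∣ + ∣ q ∣
∣p∪q∣≡∣p∣+∣q∣ [] [] _ = refl
∣p∪q∣≡∣p∣+∣q∣ (true ∷ p) (true ∷ q) p#q = contradiction here (p#q here)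
∣p∪q∣≡∣p∣+∣q∣ (true ∷ p) (false ∷ q) p#q = cong suc (∣p∪q∣≡∣p∣+∣q∣ p q (Disjoint-tail p#q))
∣p∪q∣≡∣p∣+∣q∣ (false ∷ p) (true ∷ q) p#q =
  trans (cong suc (∣p∪q∣≡∣p∣+∣q∣ p q (Disjoint-tail p#q))) (sym (ℕₚ.+-suc ∣ p ∣ ∣ q ∣))
∣p∪q∣≡∣p∣+∣q∣ (false ∷ p) (false ∷ q) p#q = ∣p∪q∣≡∣p∣+∣q∣ p q (Disjoint-tail p#q)

nonempty : ∀ {p : Subset n} → 1 ≤ ∣ p ∣ → Nonempty p
nonempty {p = true ∷ p} _ = Fin.zero , here
nonempty {p = false ∷ p} h = let z , z∈p = nonempty h in Fin.suc z , there z∈p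

∃-other-element : ∀ {p : Subset n} (i : Fin n) → 2 ≤ ∣ p ∣ → ∃[ z ] (z ∈ p × z ≢ i)
∃-other-element {p = true ∷ p} Fin.zero (s≤s h) =
  let z , z∈p = nonempty h in Fin.suc z , there z∈p , λ ()
∃-other-element {p = true ∷ p} (Fin.suc i) _ = Fin.zero , here , λ ()
∃-other-element {p = false ∷ p} Fin.zero h =
  let z , z∈p = nonempty (≤-trans (s≤s z≤n) h) in Fin.suc z , there z∈p , λ ()
∃-other-element {p = false ∷ p} (Fin.suc i) h =
  let z , z∈p , z≢i = ∃-other-element i h in Fin.suc z , there z∈p , z≢i ∘ Finₚ.suc-injective

-- Counting

indicator : Bool → ℕ
indicator true = 1
indicator false = 0

count-∷ : ∀ (p : A → Bool) x xs → count p (x ∷ xs) ≡ indicator (p x) + count p xs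
count-∷ p x xs with p x
... | true = refl
... | false = refl

count-++ : ∀ (p : A → Bool) xs ys → count p (xs ++ ys) ≡ count p xs + count p ys
count-++ p xs ys = trans (cong List.length (filter-++ (λ a → p a Bool.≟ true) xs ys))
                         (length-++ (List.filter (λ a → p a Bool.≟ true) xs))

count-map : ∀ (p : B → Bool) (f : A → B) xs → count p (List.map f xs) ≡ count (p ∘ f) xs
count-map p f [] = refl
count-map p f (x ∷ xs) rewrite count-∷ p (f x) (List.map f xs) | count-∷ (p ∘ f) x xs
  = cong (indicator (p (f x)) +_) (count-map p f xs)

count-split : ∀ {p q r : A → Bool} → (∀ a → T (p a) → T (q a) ⊎ T (r a)) →
              ∀ xs → count p xs ≤ count q xs + count r xs
count-split f [] = z≤n
count-split {p = p} {q} {r} f (x ∷ xs)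
  rewrite count-∷ p x xs | count-∷ q x xs | count-∷ r x xs = begin
    indicator (p x) + count p xs
      ≤⟨ +-mono-≤ (pointwise (f x)) (count-split f xs) ⟩
    (indicator (q x) + indicator (r x)) + (count q xs + count r xs)
      ≡⟨ +-interchange (indicator (q x)) (indicator (r x)) (count q xs) (count r xs) ⟩
    (indicator (q x) + count q xs) + (indicator (r x) + count r xs) ∎
  where
  open ≤-Reasoning
  pointwise : ∀ {a b c} → (T a → T b ⊎ T c) → indicator a ≤ indicator b + indicator c
  pointwise {false} _ = z≤n
  pointwise {true} {true} _ = s≤s z≤n
  pointwise {true} {false} {true} _ = s≤s z≤n
  pointwise {true} {false} {false} g with g tt
  ... | inj₁ ()
  ... | inj₂ ()

count-mono : ∀ {p q : A → Bool} → (∀ a → T (p a) → T (q a)) → ∀ xs → count p xs ≤ count q xs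
count-mono f [] = z≤n
count-mono {p = p} {q} f (x ∷ xs)
  rewrite count-∷ p x xs | count-∷ q x xs = +-mono-≤ (pointwise (f x)) (count-mono f xs)
  where
  pointwise : ∀ {a b} → (T a → T b) → indicator a ≤ indicator b
  pointwise {false} _ = z≤n
  pointwise {true} {true} _ = ≤-refl
  pointwise {true} {false} g = ⊥-elim (g tt)

count-never : ∀ {p : A → Bool} → (∀ a → ¬ T (p a)) → ∀ xs → count p xs ≡ 0
count-never f [] = refl
count-never {p = p} f (x ∷ xs) with p x in px
... | true = contradiction (subst T (sym px) tt) (f x)
... | false = count-never f xs

count-∧-false : ∀ (p : A → Bool) xs → count (λ a → p a ∧ false) xs ≡ 0
count-∧-false p = count-never λ a t → subst T (∧-zeroʳ (p a)) t

count-allSubsets-suc : ∀ m (p : Subset (suc m) → Bool) →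
  count p (allSubsets (suc m)) ≡ count (λ g → p (true ∷ g)) (allSubsets m) + count (λ g → p (false ∷ g)) (allSubsets m)
count-allSubsets-suc m p = go (allSubsets m)
  where
  go : ∀ gs → count p (concatMap (λ g → List.map (_∷ g) (true ∷ false ∷ [])) gs)
            ≡ count (λ g → p (true ∷ g)) gs + count (λ g → p (false ∷ g)) gs
  go [] = refl
  go (g ∷ gs)
    rewrite count-∷ p (true ∷ g) ((false ∷ g) ∷ concatMap (λ g → List.map (_∷ g) (true ∷ false ∷ [])) gs)
          | count-∷ p (false ∷ g) (concatMap (λ g → List.map (_∷ g) (true ∷ false ∷ [])) gs)
          | count-∷ (λ g → p (true ∷ g)) g gs | count-∷ (λ g → p (false ∷ g)) g gs | go gs
    = shuffle (indicator (p (true ∷ g))) (indicator (p (false ∷ g))) _ _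
    where
    shuffle : ∀ a b c d → a + (b + (c + d)) ≡ (a + c) + (b + d)
    shuffle = solve-∀

count-⊇-shift : ∀ {m} (S : Subset m) (p : Subset m → Bool) →
  count (λ e → p e ∧ (S ⊆ᵇ e)) (allSubsets m) ≡ count (λ f → p (f ∪ S) ∧ disjᵇ f S) (allSubsets m)
count-⊇-shift {zero} [] p with p []
... | true = refl
... | false = refl
count-⊇-shift {suc m} (true ∷ S) p
  rewrite count-allSubsets-suc m (λ e → p e ∧ ((true ∷ S) ⊆ᵇ e))
        | count-allSubsets-suc m (λ f → p (f ∪ (true ∷ S)) ∧ disjᵇ f (true ∷ S))
        | count-∧-false (λ g → p (false ∷ g)) (allSubsets m)
        | count-∧-false (λ g → p (true ∷ (g ∪ S))) (allSubsets m)
        | count-⊇-shift S (λ g → p (true ∷ g))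
  = ℕₚ.+-comm _ 0
count-⊇-shift {suc m} (false ∷ S) p
  rewrite count-allSubsets-suc m (λ e → p e ∧ ((false ∷ S) ⊆ᵇ e))
        | count-allSubsets-suc m (λ f → p (f ∪ (false ∷ S)) ∧ disjᵇ f (false ∷ S))
        | count-⊇-shift S (λ g → p (true ∷ g))
        | count-⊇-shift S (λ g → p (false ∷ g))
  = refl

subsetsOfSize : ℕ → Subset n → ℕ
subsetsOfSize {n} j V = count (λ g → (g ⊆ᵇ V) ∧ (∣ g ∣ ==ᵇ j)) (allSubsets n)

subsetsOfSizeMeeting : ℕ → Subset n → Subset n → ℕ
subsetsOfSizeMeeting {n} j V X = count (λ g → (g ⊆ᵇ V) ∧ (∣ g ∣ ==ᵇ j) ∧ not (disjᵇ g X)) (allSubsets n)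

private
  count-false : ∀ m → count (λ (_ : Subset m) → false) (allSubsets m) ≡ 0
  count-false m = count-never (λ _ ()) (allSubsets m)

  subsetsOfSize-outside : ∀ j (V : Subset n) → subsetsOfSize j (false ∷ V) ≡ subsetsOfSize j V
  subsetsOfSize-outside {n} j V
    rewrite count-allSubsets-suc n (λ g → (g ⊆ᵇ (false ∷ V)) ∧ (∣ g ∣ ==ᵇ j)) | count-false n = refl

  subsetsOfSize-inside : ∀ j (V : Subset n) →
    subsetsOfSize (suc j) (true ∷ V) ≡ subsetsOfSize j V + subsetsOfSize (suc j) V
  subsetsOfSize-inside {n} j V = count-allSubsets-suc n (λ g → (g ⊆ᵇ (true ∷ V)) ∧ (∣ g ∣ ==ᵇ suc j))

subsetsOfSize-0 : ∀ (V : Subset n) → subsetsOfSize 0 V ≤ 1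
subsetsOfSize-0 [] = ≤-refl
subsetsOfSize-0 {suc n} (true ∷ V)
  rewrite count-allSubsets-suc n (λ g → (g ⊆ᵇ (true ∷ V)) ∧ (∣ g ∣ ==ᵇ 0))
        | count-∧-false (_⊆ᵇ V) (allSubsets n) = subsetsOfSize-0 V
subsetsOfSize-0 (false ∷ V) rewrite subsetsOfSize-outside 0 V = subsetsOfSize-0 V

subsetsOfSize-1 : ∀ (V : Subset n) → subsetsOfSize 1 V ≤ ∣ V ∣
subsetsOfSize-1 [] = z≤n
subsetsOfSize-1 (true ∷ V) rewrite subsetsOfSize-inside 0 V = +-mono-≤ (subsetsOfSize-0 V) (subsetsOfSize-1 V)
subsetsOfSize-1 (false ∷ V) rewrite subsetsOfSize-outside 1 V = subsetsOfSize-1 V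

subsetsOfSize-2 : ∀ (V : Subset n) → 2 * subsetsOfSize 2 V + ∣ V ∣ ≤ ∣ V ∣ * ∣ V ∣
subsetsOfSize-2 [] = z≤n
subsetsOfSize-2 (true ∷ V) rewrite subsetsOfSize-inside 1 V = begin
  2 * (s₁ + s₂) + suc v         ≡⟨ regroup s₁ s₂ v ⟩
  (2 * s₁ + 1) + (2 * s₂ + v)   ≤⟨ +-mono-≤ (+-monoˡ-≤ 1 (*-monoʳ-≤ 2 (subsetsOfSize-1 V))) (subsetsOfSize-2 V) ⟩
  (2 * v + 1) + v * v           ≡⟨ square v ⟩
  suc v * suc v                 ∎
  where
  open ≤-Reasoning
  s₁ s₂ v : ℕ
  s₁ = subsetsOfSize 1 V
  s₂ = subsetsOfSize 2 V
  v = ∣ V ∣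
  regroup : ∀ a b c → 2 * (a + b) + suc c ≡ (2 * a + 1) + (2 * b + c)
  regroup = solve-∀
  square : ∀ c → (2 * c + 1) + c * c ≡ suc c * suc c
  square = solve-∀
subsetsOfSize-2 (false ∷ V) rewrite subsetsOfSize-outside 2 V = subsetsOfSize-2 V

private
  subsetsOfSizeMeeting-outside : ∀ j c (V X : Subset n) →
    subsetsOfSizeMeeting j (false ∷ V) (c ∷ X) ≡ subsetsOfSizeMeeting j V X
  subsetsOfSizeMeeting-outside {n} j c V X
    rewrite count-allSubsets-suc n (λ g → (g ⊆ᵇ (false ∷ V)) ∧ (∣ g ∣ ==ᵇ j) ∧ not (disjᵇ g (c ∷ X)))
          | count-false n = refl

  subsetsOfSizeMeeting-inside-outside : ∀ j (V X : Subset n) →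
    subsetsOfSizeMeeting (suc j) (true ∷ V) (false ∷ X) ≡ subsetsOfSizeMeeting j V X + subsetsOfSizeMeeting (suc j) V X
  subsetsOfSizeMeeting-inside-outside {n} j V X =
    count-allSubsets-suc n (λ g → (g ⊆ᵇ (true ∷ V)) ∧ (∣ g ∣ ==ᵇ suc j) ∧ not (disjᵇ g (false ∷ X)))

  subsetsOfSizeMeeting-inside-inside : ∀ j (V X : Subset n) →
    subsetsOfSizeMeeting (suc j) (true ∷ V) (true ∷ X) ≤ subsetsOfSize j V + subsetsOfSizeMeeting (suc j) V X
  subsetsOfSizeMeeting-inside-inside {n} j V X
    rewrite count-allSubsets-suc n (λ g → (g ⊆ᵇ (true ∷ V)) ∧ (∣ g ∣ ==ᵇ suc j) ∧ not (disjᵇ g (true ∷ X)))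
    = +-monoˡ-≤ _ (count-mono (λ g t → subst T (cong ((g ⊆ᵇ V) ∧_) (∧-identityʳ _)) t) (allSubsets n))

subsetsOfSizeMeeting-0 : ∀ (V X : Subset n) → subsetsOfSizeMeeting 0 V X ≡ 0
subsetsOfSizeMeeting-0 [] [] = refl
subsetsOfSizeMeeting-0 {suc n} (true ∷ V) (c ∷ X)
  rewrite count-allSubsets-suc n (λ g → (g ⊆ᵇ (true ∷ V)) ∧ (∣ g ∣ ==ᵇ 0) ∧ not (disjᵇ g (c ∷ X)))
        | count-∧-false (_⊆ᵇ V) (allSubsets n) = subsetsOfSizeMeeting-0 V X
subsetsOfSizeMeeting-0 (false ∷ V) (c ∷ X) rewrite subsetsOfSizeMeeting-outside 0 c V X = subsetsOfSizeMeeting-0 V X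

subsetsOfSizeMeeting-1 : ∀ (V X : Subset n) → subsetsOfSizeMeeting 1 V X ≤ ∣ V ∩ X ∣
subsetsOfSizeMeeting-1 [] [] = z≤n
subsetsOfSizeMeeting-1 (true ∷ V) (true ∷ X) =
  ≤-trans (subsetsOfSizeMeeting-inside-inside 0 V X) (+-mono-≤ (subsetsOfSize-0 V) (subsetsOfSizeMeeting-1 V X))
subsetsOfSizeMeeting-1 (true ∷ V) (false ∷ X)
  rewrite subsetsOfSizeMeeting-inside-outside 0 V X | subsetsOfSizeMeeting-0 V X = subsetsOfSizeMeeting-1 V X
subsetsOfSizeMeeting-1 (false ∷ V) (c ∷ X) rewrite subsetsOfSizeMeeting-outside 1 c V X = subsetsOfSizeMeeting-1 V X

subsetsOfSizeMeeting-2 : ∀ (V X : Subset n) → subsetsOfSizeMeeting 2 V X ≤ ∣ V ∩ X ∣ * ∣ V ∣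
subsetsOfSizeMeeting-2 [] [] = z≤n
subsetsOfSizeMeeting-2 (true ∷ V) (true ∷ X) = begin
  subsetsOfSizeMeeting 2 (true ∷ V) (true ∷ X)   ≤⟨ subsetsOfSizeMeeting-inside-inside 1 V X ⟩
  subsetsOfSize 1 V + subsetsOfSizeMeeting 2 V X ≤⟨ +-mono-≤ (subsetsOfSize-1 V) (subsetsOfSizeMeeting-2 V X) ⟩
  ∣ V ∣ + ∣ V ∩ X ∣ * ∣ V ∣                       ≤⟨ ℕₚ.m≤n+m _ (suc ∣ V ∩ X ∣) ⟩
  suc ∣ V ∩ X ∣ + (∣ V ∣ + ∣ V ∩ X ∣ * ∣ V ∣)     ≡⟨ expand ∣ V ∩ X ∣ ∣ V ∣ ⟩
  suc ∣ V ∩ X ∣ * suc ∣ V ∣                       ∎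
  where
  open ≤-Reasoning
  expand : ∀ a b → suc a + (b + a * b) ≡ suc a * suc b
  expand = solve-∀
subsetsOfSizeMeeting-2 (true ∷ V) (false ∷ X) rewrite subsetsOfSizeMeeting-inside-outside 1 V X = begin
  subsetsOfSizeMeeting 1 V X + subsetsOfSizeMeeting 2 V X
    ≤⟨ +-mono-≤ (subsetsOfSizeMeeting-1 V X) (subsetsOfSizeMeeting-2 V X) ⟩
  ∣ V ∩ X ∣ + ∣ V ∩ X ∣ * ∣ V ∣
    ≡⟨ sym (ℕₚ.*-suc ∣ V ∩ X ∣ ∣ V ∣) ⟩
  ∣ V ∩ X ∣ * suc ∣ V ∣ ∎
  where open ≤-Reasoning
subsetsOfSizeMeeting-2 (false ∷ V) (c ∷ X) rewrite subsetsOfSizeMeeting-outside 2 c V X = subsetsOfSizeMeeting-2 V X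

count-allVecs-suc : ∀ (xs : List A) j (q : A → Bool) (r : Vec A j → Bool) →
  count (λ w → q (Vec.head w) ∧ r (Vec.tail w)) (allVecs xs (suc j)) ≡ count q xs * count r (allVecs xs j)
count-allVecs-suc {A} xs j q r = go (allVecs xs j)
  where
  p : Vec A (suc j) → Bool
  p w = q (Vec.head w) ∧ r (Vec.tail w)
  count-∧-const : ∀ b ys → count (λ a → q a ∧ b) ys ≡ indicator b * count q ys
  count-∧-const false ys = count-∧-false q ys
  count-∧-const true ys = trans (count-∧-true ys) (sym (ℕₚ.+-identityʳ (count q ys)))
    where
    count-∧-true : ∀ ys → count (λ a → q a ∧ true) ys ≡ count q ys
    count-∧-true [] = refl
    count-∧-true (y ∷ ys) rewrite count-∷ (λ a → q a ∧ true) y ys | count-∷ q y ys | ∧-identityʳ (q y)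
      = cong (indicator (q y) +_) (count-∧-true ys)
  go : ∀ vs → count p (concatMap (λ v → List.map (_∷ v) xs) vs) ≡ count q xs * count r vs
  go [] = sym (ℕₚ.*-zeroʳ (count q xs))
  go (v ∷ vs)
    rewrite count-++ p (List.map (_∷ v) xs) (concatMap (λ v → List.map (_∷ v) xs) vs)
          | count-map p (_∷ v) xs | count-∧-const (r v) xs | go vs | count-∷ r v vs
    = distrib (count q xs) (indicator (r v)) (count r vs)
    where
    distrib : ∀ a b c → b * a + a * c ≡ a * (b + c)
    distrib = solve-∀

count-tabulate : ∀ {m} (f : Fin m → A) (p : A → Bool) (P : Subset m) →
  (∀ i → p (f i) ≡ lookup P i) → count p (List.tabulate f) ≡ ∣ P ∣
count-tabulate {m = zero} f p [] _ = refl
count-tabulate {m = suc m} f p (b ∷ P) eq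
  rewrite count-∷ p (f Fin.zero) (List.tabulate (f ∘ Fin.suc)) | eq Fin.zero
        | count-tabulate (f ∘ Fin.suc) p P (eq ∘ Fin.suc) with b
... | true = refl
... | false = refl

module _ {m : ℕ} where

  count-∈ᵇ : ∀ (P : Subset m) → count (_∈ᵇ P) (allFin m) ≡ ∣ P ∣
  count-∈ᵇ P = count-tabulate (λ i → i) (_∈ᵇ P) P (λ _ → refl)

  count-∈ᵇ-∩ : ∀ (P Q : Subset m) → count (λ a → (a ∈ᵇ P) ∧ (a ∈ᵇ Q)) (allFin m) ≡ ∣ P ∩ Q ∣
  count-∈ᵇ-∩ P Q = count-tabulate (λ i → i) _ (P ∩ Q) (λ i → sym (lookup-zipWith _∧_ i P Q))

  count-≟ : ∀ (y : Fin m) → count (λ a → does (a ≟ y)) (allFin m) ≡ 1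
  count-≟ y = trans (count-tabulate (λ i → i) _ ⁅ y ⁆ (λ i → T-injective (to i) (from i))) (∣⁅x⁆∣≡1 y)
    where
    to : ∀ i → T (does (i ≟ y)) → T (i ∈ᵇ ⁅ y ⁆)
    to i t = ∈⇒∈ᵇ (subst (_∈ ⁅ y ⁆) (sym (does⇒ {d = i ≟ y} t)) (x∈⁅x⁆ y))
    from : ∀ i → T (i ∈ᵇ ⁅ y ⁆) → T (does (i ≟ y))
    from i t = ⇒does {d = i ≟ y} (x∈⁅y⁆⇒x≡y y (∈ᵇ⇒∈ t))

  vectors : ∀ j → List (Vec (Fin m) j)
  vectors j = allVecs (allFin m) j

  allIn : ∀ {j} → Subset m → Vec (Fin m) j → Bool
  allIn V [] = true
  allIn V (a ∷ w) = (a ∈ᵇ V) ∧ allIn V w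

  meets : ∀ {j} → Subset m → Vec (Fin m) j → Bool
  meets X [] = false
  meets X (a ∷ w) = (a ∈ᵇ X) ∨ meets X w

  endsAt : ∀ {j} → Subset m → Fin m → Vec (Fin m) (suc j) → Bool
  endsAt V z w = allIn V w ∧ does (Vec.last w ≟ z)

  count-endsAt : ∀ j (V : Subset m) (z : Fin m) → count (endsAt V z) (vectors (suc j)) ≤ ∣ V ∣ ^ j
  count-endsAt zero V z = begin
    count (endsAt V z) (vectors 1)
      ≤⟨ count-mono last≡z (vectors 1) ⟩
    count (λ w → does (Vec.head w ≟ z) ∧ true) (vectors 1)
      ≡⟨ count-allVecs-suc (allFin m) 0 (λ a → does (a ≟ z)) (λ _ → true) ⟩
    count (λ a → does (a ≟ z)) (allFin m) * 1
      ≡⟨ cong (_* 1) (count-≟ z) ⟩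
    1 ∎
    where
    open ≤-Reasoning
    last≡z : ∀ w → T (endsAt V z w) → T (does (Vec.head w ≟ z) ∧ true)
    last≡z (a ∷ []) t = T-∧⁺ (proj₂ (T-∧⁻ {allIn V (a ∷ [])} t)) tt
  count-endsAt (suc j) V z = begin
    count (endsAt V z) (vectors (suc (suc j)))
      ≤⟨ count-mono peel (vectors (suc (suc j))) ⟩
    count (λ w → (Vec.head w ∈ᵇ V) ∧ endsAt V z (Vec.tail w)) (vectors (suc (suc j)))
      ≡⟨ count-allVecs-suc (allFin m) (suc j) (_∈ᵇ V) (endsAt V z) ⟩
    count (_∈ᵇ V) (allFin m) * count (endsAt V z) (vectors (suc j))
      ≤⟨ *-mono-≤ (≤-reflexive (count-∈ᵇ V)) (count-endsAt j V z) ⟩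
    ∣ V ∣ * ∣ V ∣ ^ j ∎
    where
    open ≤-Reasoning
    peel : ∀ w → T (endsAt V z w) → T ((Vec.head w ∈ᵇ V) ∧ endsAt V z (Vec.tail w))
    peel (a ∷ v@(_ ∷ _)) t with T-∧⁻ {allIn V (a ∷ v)} t
    ... | inV , last≡z with T-∧⁻ {a ∈ᵇ V} inV
    ... | a∈V , v⊆V = T-∧⁺ a∈V (T-∧⁺ v⊆V last≡z)

  private
    endsAtMeeting : ∀ {j} → Subset m → Subset m → Fin m → Vec (Fin m) (suc j) → Bool
    endsAtMeeting V X z w = endsAt V z w ∧ meets X w

    count-endsAtMeeting-1 : ∀ (V X : Subset m) z → z ∉ X → count (endsAtMeeting V X z) (vectors 1) ≡ 0
    count-endsAtMeeting-1 V X z z∉X = count-never avoids (vectors 1)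
      where
      avoids : ∀ w → ¬ T (endsAtMeeting V X z w)
      avoids (a ∷ []) t with T-∧⁻ {endsAt V z (a ∷ [])} t
      ... | ends , a∈X with T-∧⁻ {allIn V (a ∷ [])} ends
      ... | _ , a≡z with T-∨⁻ {a ∈ᵇ X} a∈X
      ... | inj₁ a∈X′ = z∉X (subst (_∈ X) (does⇒ {d = a ≟ z} a≡z) (∈ᵇ⇒∈ a∈X′))

    count-endsAtMeeting-step : ∀ j (V X : Subset m) z →
      count (endsAtMeeting V X z) (vectors (suc (suc j)))
        ≤ ∣ V ∩ X ∣ * count (endsAt V z) (vectors (suc j)) + ∣ V ∣ * count (endsAtMeeting V X z) (vectors (suc j))
    count-endsAtMeeting-step j V X z = begin
      count (endsAtMeeting V X z) (vectors (suc (suc j)))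
        ≤⟨ count-split firstOrLater (vectors (suc (suc j))) ⟩
      count first (vectors (suc (suc j))) + count later (vectors (suc (suc j)))
        ≡⟨ cong₂ _+_ (count-allVecs-suc (allFin m) (suc j) (λ a → (a ∈ᵇ V) ∧ (a ∈ᵇ X)) (endsAt V z))
                     (count-allVecs-suc (allFin m) (suc j) (_∈ᵇ V) (endsAtMeeting V X z)) ⟩
      count (λ a → (a ∈ᵇ V) ∧ (a ∈ᵇ X)) (allFin m) * ends + count (_∈ᵇ V) (allFin m) * endsMeeting
        ≡⟨ cong₂ (λ a b → a * ends + b * endsMeeting) (count-∈ᵇ-∩ V X) (count-∈ᵇ V) ⟩
      ∣ V ∩ X ∣ * ends + ∣ V ∣ * endsMeeting ∎
      where
      open ≤-Reasoning
      ends endsMeeting : ℕ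
      ends = count (endsAt V z) (vectors (suc j))
      endsMeeting = count (endsAtMeeting V X z) (vectors (suc j))
      first later : Vec (Fin m) (suc (suc j)) → Bool
      first w = ((Vec.head w ∈ᵇ V) ∧ (Vec.head w ∈ᵇ X)) ∧ endsAt V z (Vec.tail w)
      later w = (Vec.head w ∈ᵇ V) ∧ endsAtMeeting V X z (Vec.tail w)
      firstOrLater : ∀ w → T (endsAtMeeting V X z w) → T (first w) ⊎ T (later w)
      firstOrLater (a ∷ v@(_ ∷ _)) t with T-∧⁻ {endsAt V z (a ∷ v)} t
      ... | ends , hit with T-∧⁻ {allIn V (a ∷ v)} ends
      ... | inV , last≡z with T-∧⁻ {a ∈ᵇ V} inV
      ... | a∈V , v⊆V with T-∨⁻ {a ∈ᵇ X} hit
      ... | inj₁ a∈X = inj₁ (T-∧⁺ (T-∧⁺ a∈V a∈X) (T-∧⁺ v⊆V last≡z))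
      ... | inj₂ v∩X = inj₂ (T-∧⁺ a∈V (T-∧⁺ (T-∧⁺ v⊆V last≡z) v∩X))

  -- A sequence of j + 2 vertices of V ending outside X can meet X in any of its first j + 1 places.
  count-endsAt-meets : ∀ j (V X : Subset m) z → z ∉ X →
    count (λ w → endsAt V z w ∧ meets X w) (vectors (suc (suc j))) ≤ suc j * ∣ V ∩ X ∣ * ∣ V ∣ ^ j
  count-endsAt-meets zero V X z z∉X = begin
    count (endsAtMeeting V X z) (vectors 2)                                         ≤⟨ count-endsAtMeeting-step 0 V X z ⟩
    ∣ V ∩ X ∣ * count (endsAt V z) (vectors 1) + ∣ V ∣ * count (endsAtMeeting V X z) (vectors 1)
      ≤⟨ +-mono-≤ (*-monoʳ-≤ ∣ V ∩ X ∣ (count-endsAt 0 V z)) (≤-reflexive (cong (∣ V ∣ *_) (count-endsAtMeeting-1 V X z z∉X))) ⟩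
    ∣ V ∩ X ∣ * 1 + ∣ V ∣ * 0                                                       ≡⟨ simplify ∣ V ∩ X ∣ ∣ V ∣ ⟩
    1 * ∣ V ∩ X ∣ * 1                                                               ∎
    where
    open ≤-Reasoning
    simplify : ∀ a b → a * 1 + b * 0 ≡ 1 * a * 1
    simplify = solve-∀
  count-endsAt-meets (suc j) V X z z∉X = begin
    count (endsAtMeeting V X z) (vectors (suc (suc (suc j))))                   ≤⟨ count-endsAtMeeting-step (suc j) V X z ⟩
    t * count (endsAt V z) (vectors (suc (suc j))) + v * count (endsAtMeeting V X z) (vectors (suc (suc j)))
      ≤⟨ +-mono-≤ (*-monoʳ-≤ t (count-endsAt (suc j) V z)) (*-monoʳ-≤ v (count-endsAt-meets j V X z z∉X)) ⟩
    t * v ^ suc j + v * (suc j * t * v ^ j)                                     ≡⟨ collect t v (v ^ j) j ⟩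
    suc (suc j) * t * v ^ suc j                                                 ∎
    where
    open ≤-Reasoning
    t v : ℕ
    t = ∣ V ∩ X ∣
    v = ∣ V ∣
    collect : ∀ t v p j → t * (v * p) + v * (suc j * t * p) ≡ suc (suc j) * t * (v * p)
    collect = solve-∀

-- Rational arithmetic

-- Without a genuine zero test the solver cannot cancel rational constants such as 2/3 - 2/3.
ℚring : ACR.AlmostCommutativeRing _ _
ℚring = ACR.fromCommutativeRing ℚₚ.+-*-commutativeRing (λ x → dec⇒maybe (0ℚ ℚₚ.≟ x))

toℚ≡mkℚ : ∀ a → toℚ a ≡ mkℚ (ℤ.+ a) 0 (Coprime.sym (Coprime.1-coprimeTo a))
toℚ≡mkℚ a = ℚₚ.normalize-coprime (Coprime.sym (Coprime.1-coprimeTo a))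

toℚ-+ : ∀ a b → toℚ (a + b) ≡ toℚ a ℚ.+ toℚ b
toℚ-+ a b rewrite toℚ≡mkℚ a | toℚ≡mkℚ b =
  cong (ℚ._/ 1) (trans (ℤₚ.pos-+ a b) (sym (cong₂ ℤ._+_ (ℤₚ.*-identityʳ (ℤ.+ a)) (ℤₚ.*-identityʳ (ℤ.+ b)))))

toℚ-* : ∀ a b → toℚ (a * b) ≡ toℚ a ℚ.* toℚ b
toℚ-* a b rewrite toℚ≡mkℚ a | toℚ≡mkℚ b = cong (ℚ._/ 1) (ℤₚ.pos-* a b)

toℚ-mono-≤ : ∀ {a b} → a ≤ b → toℚ a ℚ.≤ toℚ b
toℚ-mono-≤ {a} {b} a≤b rewrite toℚ≡mkℚ a | toℚ≡mkℚ b =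
  ℚ.*≤* (subst₂ ℤ._≤_ (sym (ℤₚ.*-identityʳ (ℤ.+ a))) (sym (ℤₚ.*-identityʳ (ℤ.+ b))) (ℤ.+≤+ a≤b))

toℚ-cancel-≤ : ∀ {a b} → toℚ a ℚ.≤ toℚ b → a ≤ b
toℚ-cancel-≤ {a} {b} h rewrite toℚ≡mkℚ a | toℚ≡mkℚ b with h
... | ℚ.*≤* a≤b = ℤₚ.drop‿+≤+ (subst₂ ℤ._≤_ (ℤₚ.*-identityʳ (ℤ.+ a)) (ℤₚ.*-identityʳ (ℤ.+ b)) a≤b)

0≤toℚ : ∀ a → 0ℚ ℚ.≤ toℚ a
0≤toℚ a = toℚ-mono-≤ {0} {a} z≤n

toℚ-suc-pos : ∀ a → Positive (toℚ (suc a))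
toℚ-suc-pos a rewrite toℚ≡mkℚ (suc a) = _

0≤-⇒≤ : ∀ {a b} → 0ℚ ℚ.≤ b - a → a ℚ.≤ b
0≤-⇒≤ {a} {b} 0≤b-a = subst₂ ℚ._≤_ (ℚₚ.+-identityʳ a) (a+[b-a]≡b a b) (ℚₚ.+-monoʳ-≤ a 0≤b-a)
  where
  a+[b-a]≡b : ∀ a b → a ℚ.+ (b - a) ≡ b
  a+[b-a]≡b = solve-∀-ring ℚring

≤⇒0≤- : ∀ {a b} → a ℚ.≤ b → 0ℚ ℚ.≤ b - a
≤⇒0≤- {a} {b} a≤b = subst (ℚ._≤ b - a) (ℚₚ.+-inverseʳ a) (ℚₚ.+-monoˡ-≤ (ℚ.- a) a≤b)

0≤+ : ∀ {x y} → 0ℚ ℚ.≤ x → 0ℚ ℚ.≤ y → 0ℚ ℚ.≤ x ℚ.+ y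
0≤+ = ℚₚ.+-mono-≤

0≤* : ∀ {x y} → 0ℚ ℚ.≤ x → 0ℚ ℚ.≤ y → 0ℚ ℚ.≤ x ℚ.* y
0≤* {x} {y} 0≤x 0≤y =
  ℚₚ.nonNegative⁻¹ _ {{ℚₚ.nonNeg*nonNeg⇒nonNeg x {{ℚ.nonNegative 0≤x}} y {{ℚ.nonNegative 0≤y}}}}

≤-by-difference : ∀ {a b} d → 0ℚ ℚ.≤ d → b - a ≡ d → a ℚ.≤ b
≤-by-difference d 0≤d b-a≡d = 0≤-⇒≤ (subst (0ℚ ℚ.≤_) (sym b-a≡d) 0≤d)

divℕ-*-toℚ : ∀ q d → divℕ q (suc d) ℚ.* toℚ (suc d) ≡ q
divℕ-*-toℚ q d = begin
  q ℚ.* (ℤ.+ 1 ℚ./ suc d) ℚ.* toℚ (suc d)   ≡⟨ ℚₚ.*-assoc q _ _ ⟩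
  q ℚ.* ((ℤ.+ 1 ℚ./ suc d) ℚ.* toℚ (suc d)) ≡⟨ cong (q ℚ.*_) inverse ⟩
  q ℚ.* 1ℚ                                ≡⟨ ℚₚ.*-identityʳ q ⟩
  q                                       ∎
  where
  open ≡-Reasoning
  inverse : (ℤ.+ 1 ℚ./ suc d) ℚ.* toℚ (suc d) ≡ 1ℚ
  inverse rewrite toℚ≡mkℚ (suc d) | ℚₚ.normalize-coprime {1} {d} (Coprime.1-coprimeTo (suc d)) =
    ℚₚ.*-inverseˡ (mkℚ (ℤ.+ suc d) 0 (Coprime.sym (Coprime.1-coprimeTo (suc d))))

*-divℕ-≤ : ∀ q d t x → toℚ t ℚ.≤ divℕ q (suc d) ℚ.* x → toℚ (suc d * t) ℚ.≤ q ℚ.* x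
*-divℕ-≤ q d t x t≤ = begin
  toℚ (suc d * t)                              ≡⟨ toℚ-* (suc d) t ⟩
  toℚ (suc d) ℚ.* toℚ t                        ≤⟨ ℚₚ.*-monoˡ-≤-nonNeg (toℚ (suc d)) {{ℚ.nonNegative (0≤toℚ (suc d))}} t≤ ⟩
  toℚ (suc d) ℚ.* (divℕ q (suc d) ℚ.* x)        ≡⟨ rearrange (toℚ (suc d)) (divℕ q (suc d)) x ⟩
  (divℕ q (suc d) ℚ.* toℚ (suc d)) ℚ.* x        ≡⟨ cong (ℚ._* x) (divℕ-*-toℚ q d) ⟩
  q ℚ.* x                                      ∎
  where
  open ℚₚ.≤-Reasoning
  rearrange : ∀ a b c → a ℚ.* (b ℚ.* c) ≡ (b ℚ.* a) ℚ.* c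
  rearrange = solve-∀-ring ℚring

ϑ*-≤ : ∀ α β ℓ n {q} → ϑ α β ℓ ℚ.≤ q → ϑ α β ℓ ℚ.* toℚ n ℚ.≤ q ℚ.* toℚ n
ϑ*-≤ α β ℓ n = ℚₚ.*-monoʳ-≤-nonNeg (toℚ n) {{ℚ.nonNegative (0≤toℚ n)}}

ϑ-bound-α : ∀ α β ℓ t n → toℚ t ℚ.≤ ϑ α β ℓ ℚ.* toℚ n → toℚ (4 * t) ℚ.≤ α ℚ.* toℚ n
ϑ-bound-α α β ℓ t n t≤ϑn = *-divℕ-≤ α 3 t (toℚ n) (ℚₚ.≤-trans t≤ϑn (ϑ*-≤ α β ℓ n (ℚₚ.p⊓q≤p (divℕ α 4) (divℕ β (2 * ℓ)))))

ϑ-bound-β : ∀ α β ℓ t n → toℚ t ℚ.≤ ϑ α β (suc ℓ) ℚ.* toℚ n → toℚ (2 * suc ℓ * t) ℚ.≤ β ℚ.* toℚ n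
ϑ-bound-β α β ℓ t n t≤ϑn =
  *-divℕ-≤ β (ℓ + suc (ℓ + 0)) t (toℚ n) (ℚₚ.≤-trans t≤ϑn (ϑ*-≤ α β (suc ℓ) n (ℚₚ.p⊓q≤q (divℕ α 4) (divℕ β (2 * suc ℓ)))))

0≤*-cancelˡ : ∀ k x → 1 ≤ k → 0ℚ ℚ.≤ toℚ k ℚ.* x → 0ℚ ℚ.≤ x
0≤*-cancelˡ (suc a) x _ 0≤ax = ℚₚ.*-cancelˡ-≤-pos (toℚ (suc a)) {{toℚ-suc-pos a}}
  (subst (ℚ._≤ toℚ (suc a) ℚ.* x) (sym (ℚₚ.*-zeroʳ (toℚ (suc a)))) 0≤ax)

-- Each inequality below exhibits b - a as a sum of products of non-negative quantities.
radius-inequality : ∀ α (n n′ t r r′ : ℕ) → 0ℚ ℚ.≤ α →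
  (twoThirds ℚ.+ α ℚ.* ½) ℚ.* toℚ n ℚ.≤ toℚ r → r ≤ r′ + t → n′ + t ≤ n → toℚ (4 * t) ℚ.≤ α ℚ.* toℚ n →
  (twoThirds ℚ.+ α ℚ.* ½ ℚ.* ½) ℚ.* toℚ n′ ℚ.≤ toℚ r′
radius-inequality α n n′ t r r′ 0≤α r-large r≤r′+t n′+t≤n 4t≤αn = ≤-by-difference _
  (0≤+ (0≤+ (0≤+ (0≤+ (≤⇒0≤- r-large) (≤⇒0≤- r≤)) (0≤* 0≤c (≤⇒0≤- n′+t≤)))
            (0≤* (ℚₚ.nonNegative⁻¹ (½ ℚ.* ½)) (≤⇒0≤- 4t≤)))
       (0≤* 0≤c (0≤toℚ t)))
  (identity α (toℚ n) (toℚ n′) (toℚ t) (toℚ r) (toℚ r′))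
  where
  c : ℚ
  c = twoThirds ℚ.+ α ℚ.* ½ ℚ.* ½
  0≤c : 0ℚ ℚ.≤ c
  0≤c = 0≤+ (ℚₚ.nonNegative⁻¹ twoThirds) (0≤* (0≤* 0≤α (ℚₚ.nonNegative⁻¹ ½)) (ℚₚ.nonNegative⁻¹ ½))
  r≤ : toℚ r ℚ.≤ toℚ r′ ℚ.+ toℚ t
  r≤ = subst (toℚ r ℚ.≤_) (toℚ-+ r′ t) (toℚ-mono-≤ r≤r′+t)
  n′+t≤ : toℚ n′ ℚ.+ toℚ t ℚ.≤ toℚ n
  n′+t≤ = subst (ℚ._≤ toℚ n) (toℚ-+ n′ t) (toℚ-mono-≤ n′+t≤n)
  4t≤ : toℚ 4 ℚ.* toℚ t ℚ.≤ α ℚ.* toℚ n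
  4t≤ = subst (ℚ._≤ α ℚ.* toℚ n) (toℚ-* 4 t) 4t≤αn
  identity : ∀ a n n′ t r r′ → r′ - (twoThirds ℚ.+ a ℚ.* ½ ℚ.* ½) ℚ.* n′ ≡
    (r - (twoThirds ℚ.+ a ℚ.* ½) ℚ.* n) ℚ.+ ((r′ ℚ.+ t) - r)
    ℚ.+ (twoThirds ℚ.+ a ℚ.* ½ ℚ.* ½) ℚ.* (n - (n′ ℚ.+ t))
    ℚ.+ ½ ℚ.* ½ ℚ.* (a ℚ.* n - toℚ 4 ℚ.* t) ℚ.+ (twoThirds ℚ.+ a ℚ.* ½ ℚ.* ½) ℚ.* t
  identity = solve-∀-ring ℚring

codegree-inequality : ∀ α (n n′ D D′ t : ℕ) → 0ℚ ℚ.≤ α →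
  (fiveNinths ℚ.+ α) ℚ.* toℚ (n * n) ℚ.* ½ ℚ.≤ toℚ D → D ≤ D′ + t * n → toℚ (4 * t) ℚ.≤ α ℚ.* toℚ n → n′ ≤ n →
  (fiveNinths ℚ.+ α ℚ.* ½) ℚ.* toℚ (n′ * n′) ℚ.* ½ ℚ.≤ toℚ D′
codegree-inequality α n n′ D D′ t 0≤α D-large D≤D′+tn 4t≤αn n′≤n = ≤-by-difference _
  (0≤+ (0≤+ (0≤+ (≤⇒0≤- D-large′) (≤⇒0≤- D≤))
            (0≤* (0≤* (0≤toℚ n) (ℚₚ.nonNegative⁻¹ (½ ℚ.* ½))) (≤⇒0≤- 4t≤)))
       (0≤* (0≤* (0≤+ (ℚₚ.nonNegative⁻¹ fiveNinths) (0≤* 0≤α (ℚₚ.nonNegative⁻¹ ½))) (ℚₚ.nonNegative⁻¹ ½))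
            (≤⇒0≤- n′²≤n²)))
  (identity α (toℚ n) (toℚ (n′ * n′)) (toℚ D) (toℚ D′) (toℚ t))
  where
  D-large′ : (fiveNinths ℚ.+ α) ℚ.* (toℚ n ℚ.* toℚ n) ℚ.* ½ ℚ.≤ toℚ D
  D-large′ = subst (λ y → (fiveNinths ℚ.+ α) ℚ.* y ℚ.* ½ ℚ.≤ toℚ D) (toℚ-* n n) D-large
  D≤ : toℚ D ℚ.≤ toℚ D′ ℚ.+ toℚ t ℚ.* toℚ n
  D≤ = subst (toℚ D ℚ.≤_) (trans (toℚ-+ D′ (t * n)) (cong (toℚ D′ ℚ.+_) (toℚ-* t n))) (toℚ-mono-≤ D≤D′+tn)
  4t≤ : toℚ 4 ℚ.* toℚ t ℚ.≤ α ℚ.* toℚ n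
  4t≤ = subst (ℚ._≤ α ℚ.* toℚ n) (toℚ-* 4 t) 4t≤αn
  n′²≤n² : toℚ (n′ * n′) ℚ.≤ toℚ n ℚ.* toℚ n
  n′²≤n² = subst (toℚ (n′ * n′) ℚ.≤_) (toℚ-* n n) (toℚ-mono-≤ (ℕₚ.*-mono-≤ n′≤n n′≤n))
  identity : ∀ a n y D D′ t → D′ - (fiveNinths ℚ.+ a ℚ.* ½) ℚ.* y ℚ.* ½ ≡
    (D - (fiveNinths ℚ.+ a) ℚ.* (n ℚ.* n) ℚ.* ½) ℚ.+ ((D′ ℚ.+ t ℚ.* n) - D)
    ℚ.+ n ℚ.* (½ ℚ.* ½) ℚ.* (a ℚ.* n - toℚ 4 ℚ.* t)
    ℚ.+ (fiveNinths ℚ.+ a ℚ.* ½) ℚ.* ½ ℚ.* (n ℚ.* n - y)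
  identity = solve-∀-ring ℚring

crossing-inequality : ∀ μ (n n′ c c′ : ℕ) → 0ℚ ℚ.≤ μ →
  c′ ≤ c → toℚ c ℚ.≤ μ ℚ.* toℚ (n * n) → n * n ≤ 2 * (n′ * n′) →
  toℚ c′ ℚ.≤ toℚ 2 ℚ.* μ ℚ.* toℚ (n′ * n′)
crossing-inequality μ n n′ c c′ 0≤μ c′≤c c≤μn² n²≤2n′² = begin
  toℚ c′                         ≤⟨ toℚ-mono-≤ c′≤c ⟩
  toℚ c                          ≤⟨ c≤μn² ⟩
  μ ℚ.* toℚ (n * n)              ≤⟨ ℚₚ.*-monoˡ-≤-nonNeg μ {{ℚ.nonNegative 0≤μ}} (toℚ-mono-≤ n²≤2n′²) ⟩
  μ ℚ.* toℚ (2 * (n′ * n′))      ≡⟨ cong (μ ℚ.*_) (toℚ-* 2 (n′ * n′)) ⟩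
  μ ℚ.* (toℚ 2 ℚ.* toℚ (n′ * n′))  ≡⟨ rearrange μ (toℚ 2) (toℚ (n′ * n′)) ⟩
  toℚ 2 ℚ.* μ ℚ.* toℚ (n′ * n′)    ∎
  where
  open ℚₚ.≤-Reasoning
  rearrange : ∀ a b c → a ℚ.* (b ℚ.* c) ≡ b ℚ.* a ℚ.* c
  rearrange = solve-∀-ring ℚring

-- Since twice the codegree is at most n² - n, the degree condition forces α < 4/9.
deleted-ninth : ∀ α (n D t : ℕ) → 1 ≤ n →
  (fiveNinths ℚ.+ α) ℚ.* toℚ (n * n) ℚ.* ½ ℚ.≤ toℚ D → 2 * D + n ≤ n * n → toℚ (4 * t) ℚ.≤ α ℚ.* toℚ n →
  9 * t ≤ n
deleted-ninth α n@(suc _) D t _ D-large 2D+n≤n² 4t≤αn =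
  toℚ-cancel-≤ (subst (ℚ._≤ toℚ n) (sym (toℚ-* 9 t)) (0≤-⇒≤ (0≤*-cancelˡ n (toℚ n - toℚ 9 ℚ.* toℚ t) (s≤s z≤n) n[n-9t]≥0)))
  where
  D-large′ : (fiveNinths ℚ.+ α) ℚ.* (toℚ n ℚ.* toℚ n) ℚ.* ½ ℚ.≤ toℚ D
  D-large′ = subst (λ y → (fiveNinths ℚ.+ α) ℚ.* y ℚ.* ½ ℚ.≤ toℚ D) (toℚ-* n n) D-large
  2D+n≤ : toℚ 2 ℚ.* toℚ D ℚ.+ toℚ n ℚ.≤ toℚ n ℚ.* toℚ n
  2D+n≤ = subst₂ ℚ._≤_ (trans (toℚ-+ (2 * D) n) (cong (ℚ._+ toℚ n) (toℚ-* 2 D))) (toℚ-* n n) (toℚ-mono-≤ 2D+n≤n²)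
  4t≤ : toℚ 4 ℚ.* toℚ t ℚ.≤ α ℚ.* toℚ n
  4t≤ = subst (ℚ._≤ α ℚ.* toℚ n) (toℚ-* 4 t) 4t≤αn
  identity : ∀ a n D t → n ℚ.* (n - toℚ 9 ℚ.* t) ≡
    (ℤ.+ 9 ℚ./ 4) ℚ.* ((((n ℚ.* n) - (toℚ 2 ℚ.* D ℚ.+ n))
                     ℚ.+ toℚ 2 ℚ.* (D - (fiveNinths ℚ.+ a) ℚ.* (n ℚ.* n) ℚ.* ½))
                     ℚ.+ n ℚ.* (a ℚ.* n - toℚ 4 ℚ.* t) ℚ.+ n)
  identity = solve-∀-ring ℚring
  n[n-9t]≥0 : 0ℚ ℚ.≤ toℚ n ℚ.* (toℚ n - toℚ 9 ℚ.* toℚ t)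
  n[n-9t]≥0 = subst (0ℚ ℚ.≤_) (sym (identity α (toℚ n) (toℚ D) (toℚ t)))
    (0≤* (ℚₚ.nonNegative⁻¹ (ℤ.+ 9 ℚ./ 4))
         (0≤+ (0≤+ (0≤+ (≤⇒0≤- 2D+n≤) (0≤* (0≤toℚ 2) (≤⇒0≤- D-large′))) (0≤* (0≤toℚ n) (≤⇒0≤- 4t≤))) (0≤toℚ n)))

radius≥2 : ∀ α (n r : ℕ) → 0ℚ ℚ.≤ α → 12 ≤ n → (twoThirds ℚ.+ α ℚ.* ½) ℚ.* toℚ n ℚ.≤ toℚ r → 2 ≤ r
radius≥2 α n r 0≤α 12≤n r-large = toℚ-cancel-≤ (≤-by-difference _
  (0≤+ (0≤+ (0≤+ (≤⇒0≤- r-large) (0≤* (0≤* 0≤α (ℚₚ.nonNegative⁻¹ ½)) (0≤toℚ n)))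
            (0≤* (ℚₚ.nonNegative⁻¹ twoThirds) (≤⇒0≤- (toℚ-mono-≤ 12≤n))))
       (0≤toℚ 6))
  (identity α (toℚ n) (toℚ r)))
  where
  identity : ∀ a n r → r - toℚ 2 ≡
    (r - (twoThirds ℚ.+ a ℚ.* ½) ℚ.* n) ℚ.+ a ℚ.* ½ ℚ.* n ℚ.+ twoThirds ℚ.* (n - toℚ 12) ℚ.+ toℚ 6
  identity = solve-∀-ring ℚring

¬*toℚ≤0 : ∀ β a → Positive β → 1 ≤ a → ¬ (β ℚ.* toℚ a ℚ.≤ 0ℚ)
¬*toℚ≤0 β (suc a) β>0 _ βa≤0 = ℚₚ.<-irrefl refl (ℚₚ.<-≤-trans 0<βa βa≤0)
  where
  0<βa : 0ℚ ℚ.< β ℚ.* toℚ (suc a)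
  0<βa = ℚₚ.positive⁻¹ _ {{ℚₚ.pos*pos⇒pos β {{β>0}} (toℚ (suc a)) {{toℚ-suc-pos a}}}}

path-inequality : ∀ β j (n n′ t P P′ c : ℕ) → 0ℚ ℚ.≤ β →
  β ℚ.* toℚ (n ^ suc j) ℚ.≤ toℚ P → P ≤ P′ + c → c ≤ suc j * t * n ^ j →
  toℚ (2 * suc (suc j) * t) ℚ.≤ β ℚ.* toℚ n → n′ ≤ n →
  β ℚ.* ½ ℚ.* toℚ (n′ ^ suc j) ℚ.≤ toℚ P′
path-inequality β j n n′ t P P′ c 0≤β P-large P≤P′+c c≤ 2ℓt≤βn n′≤n = ≤-by-difference _
  (0≤+ (0≤+ (0≤+ (≤⇒0≤- P≤) (≤⇒0≤- P-large′)) (≤⇒0≤- c≤half)) (0≤* β/2≥0 (≤⇒0≤- n′^≤)))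
  (identity β (toℚ n) p (toℚ c) (toℚ P) (toℚ P′) (toℚ (n′ ^ suc j)))
  where
  p jℚ : ℚ
  p = toℚ (n ^ j)
  jℚ = toℚ j
  β/2≥0 : 0ℚ ℚ.≤ β ℚ.* ½
  β/2≥0 = 0≤* 0≤β (ℚₚ.nonNegative⁻¹ ½)
  P-large′ : β ℚ.* (toℚ n ℚ.* p) ℚ.≤ toℚ P
  P-large′ = subst (λ y → β ℚ.* y ℚ.≤ toℚ P) (toℚ-* n (n ^ j)) P-large
  P≤ : toℚ P ℚ.≤ toℚ P′ ℚ.+ toℚ c
  P≤ = subst (toℚ P ℚ.≤_) (toℚ-+ P′ c) (toℚ-mono-≤ P≤P′+c)
  n′^≤ : toℚ (n′ ^ suc j) ℚ.≤ toℚ n ℚ.* p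
  n′^≤ = subst (toℚ (n′ ^ suc j) ℚ.≤_) (toℚ-* n (n ^ j)) (toℚ-mono-≤ (ℕₚ.^-monoˡ-≤ (suc j) n′≤n))
  K≡ : toℚ (2 * suc (suc j)) ≡ toℚ 2 ℚ.* (toℚ 2 ℚ.+ jℚ)
  K≡ = trans (toℚ-* 2 (suc (suc j))) (cong (toℚ 2 ℚ.*_) (toℚ-+ 2 j))
  c≤′ : toℚ c ℚ.≤ (toℚ 1 ℚ.+ jℚ) ℚ.* toℚ t ℚ.* p
  c≤′ = subst (toℚ c ℚ.≤_)
              (trans (toℚ-* (suc j * t) (n ^ j)) (cong (ℚ._* p) (trans (toℚ-* (suc j) t) (cong (ℚ._* toℚ t) (toℚ-+ 1 j)))))
              (toℚ-mono-≤ c≤)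
  2ℓt≤ : toℚ 2 ℚ.* (toℚ 2 ℚ.+ jℚ) ℚ.* toℚ t ℚ.≤ β ℚ.* toℚ n
  2ℓt≤ = subst (ℚ._≤ β ℚ.* toℚ n) (trans (toℚ-* (2 * suc (suc j)) t) (cong (ℚ._* toℚ t) K≡)) 2ℓt≤βn
  -- c is at most a (j + 1)/(2j + 4) fraction of β n^{j+1}.
  c≤half : toℚ c ℚ.≤ β ℚ.* ½ ℚ.* (toℚ n ℚ.* p)
  c≤half = 0≤-⇒≤ (0≤*-cancelˡ (2 * suc (suc j)) (β ℚ.* ½ ℚ.* (toℚ n ℚ.* p) - toℚ c) (s≤s z≤n)
    (subst (λ k → 0ℚ ℚ.≤ k ℚ.* (β ℚ.* ½ ℚ.* (toℚ n ℚ.* p) - toℚ c)) (sym K≡)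
      (subst (0ℚ ℚ.≤_) (sym (scaled β (toℚ n) p (toℚ c) jℚ (toℚ t)))
        (0≤+ (0≤+ (0≤* (0≤* (0≤+ (0≤toℚ 1) (0≤toℚ j)) (0≤toℚ (n ^ j))) (≤⇒0≤- 2ℓt≤))
                  (0≤* (0≤* (0≤toℚ 2) (0≤+ (0≤toℚ 2) (0≤toℚ j))) (≤⇒0≤- c≤′)))
             (0≤* (0≤* 0≤β (0≤toℚ n)) (0≤toℚ (n ^ j)))))))
    where
    scaled : ∀ b x p c jℚ t → toℚ 2 ℚ.* (toℚ 2 ℚ.+ jℚ) ℚ.* (b ℚ.* ½ ℚ.* (x ℚ.* p) - c) ≡
      (toℚ 1 ℚ.+ jℚ) ℚ.* p ℚ.* (b ℚ.* x - toℚ 2 ℚ.* (toℚ 2 ℚ.+ jℚ) ℚ.* t)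
      ℚ.+ toℚ 2 ℚ.* (toℚ 2 ℚ.+ jℚ) ℚ.* ((toℚ 1 ℚ.+ jℚ) ℚ.* t ℚ.* p - c) ℚ.+ b ℚ.* x ℚ.* p
    scaled = solve-∀-ring ℚring
  identity : ∀ b x p c P P′ q → P′ - b ℚ.* ½ ℚ.* q ≡
    ((P′ ℚ.+ c) - P) ℚ.+ (P - b ℚ.* (x ℚ.* p)) ℚ.+ (b ℚ.* ½ ℚ.* (x ℚ.* p) - c) ℚ.+ b ℚ.* ½ ℚ.* (x ℚ.* p - q)
  identity = solve-∀-ring ℚring

module _ {m : ℕ} where

  consecutive-mono : ∀ {j} {P : Fin m → Set} {adj adj′ : Fin m → Fin m → Bool} →
    (∀ {a b} → P a → P b → T (adj a b) → T (adj′ a b)) →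
    (w : Vec (Fin m) j) → All P w → T (consecutive adj w) → T (consecutive adj′ w)
  consecutive-mono f [] _ _ = tt
  consecutive-mono f (a ∷ []) _ _ = tt
  consecutive-mono {adj = adj} f (a ∷ b ∷ w) (pa ∷ pb ∷ pw) t =
    let ab , rest = T-∧⁻ {adj a b} t in T-∧⁺ (f pa pb ab) (consecutive-mono f (b ∷ w) (pb ∷ pw) rest)

  consecutive-targets : ∀ {j} {Q : Fin m → Set} {adj : Fin m → Fin m → Bool} →
    (∀ {a b} → T (adj a b) → Q b) → ∀ a (w : Vec (Fin m) j) → T (consecutive adj (a ∷ w)) → All Q w
  consecutive-targets f a [] _ = []
  consecutive-targets {adj = adj} f a (b ∷ w) t =
    let ab , rest = T-∧⁻ {adj a b} t in f ab ∷ consecutive-targets f b w rest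

  All⇒allIn : ∀ {j} {V : Subset m} (w : Vec (Fin m) j) → All (_∈ V) w → T (allIn V w)
  All⇒allIn [] [] = tt
  All⇒allIn (a ∷ w) (a∈V ∷ w⊆V) = T-∧⁺ (∈⇒∈ᵇ a∈V) (All⇒allIn w w⊆V)

  ¬meets⇒All : ∀ {j} {X : Subset m} (w : Vec (Fin m) j) → ¬ T (meets X w) → All (_∉ X) w
  ¬meets⇒All [] _ = []
  ¬meets⇒All {X = X} (a ∷ w) ¬hit =
    (λ a∈X → ¬hit (T-∨⁺ˡ (∈⇒∈ᵇ a∈X))) ∷ ¬meets⇒All w (λ hit → ¬hit (T-∨⁺ʳ {a ∈ᵇ X} hit))

  record IsPath {ℓ} (adj : Fin m → Fin m → Bool) (y z : Fin m) (w : Vec (Fin m) (suc ℓ)) : Set where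
    field
      head≡ : Vec.head w ≡ y
      last≡ : Vec.last w ≡ z
      distinct : T (allDistinct w)
      steps : T (consecutive adj w)

  isPath⇒IsPath : ∀ {ℓ adj y z} (w : Vec (Fin m) (suc ℓ)) → T (isPath adj ℓ y z w) → IsPath adj y z w
  isPath⇒IsPath {y = y} {z} w t with Vec.head w ≟ y | Vec.last w ≟ z
  ... | yes head≡ | yes last≡ = let distinct , steps = T-∧⁻ {allDistinct w} t in
    record { head≡ = head≡ ; last≡ = last≡ ; distinct = distinct ; steps = steps }

  IsPath⇒isPath : ∀ {ℓ adj y z} (w : Vec (Fin m) (suc ℓ)) → IsPath adj y z w → T (isPath adj ℓ y z w)
  IsPath⇒isPath {y = y} {z} w p with Vec.head w ≟ y | Vec.last w ≟ z
  ... | yes _ | yes _ = T-∧⁺ distinct steps where open IsPath p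
  ... | no head≢ | _ = head≢ (IsPath.head≡ p)
  ... | yes _ | no last≢ = last≢ (IsPath.last≡ p)

  record IsRAdjacent (Ψ : Constellation m) (x : Subset m) (a b : Fin m) : Set where
    field
      a∈R : a ∈ R Ψ x
      b∈R : b ∈ R Ψ x
      a≢b : a ≢ b
      a∉x : a ∉ x
      b∉x : b ∉ x
      edge : T (E Ψ (x ∪ (⁅ a ⁆ ∪ ⁅ b ⁆)))

  adjR⇒IsRAdjacent : ∀ Ψ x a b → T (adjR Ψ x a b) → IsRAdjacent Ψ x a b
  adjR⇒IsRAdjacent Ψ x a b t =
    let a∈R , t₁ = T-∧⁻ {a ∈ᵇ R Ψ x} t
        b∈R , t₂ = T-∧⁻ {b ∈ᵇ R Ψ x} t₁
        a≢b , t₃ = T-∧⁻ {a ≠ᶠ b} t₂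
        a∉x , t₄ = T-∧⁻ {not (a ∈ᵇ x)} t₃
        b∉x , e = T-∧⁻ {not (b ∈ᵇ x)} t₄
    in record { a∈R = ∈ᵇ⇒∈ a∈R ; b∈R = ∈ᵇ⇒∈ b∈R ; a≢b = ≠ᶠ⇒≢ a≢b
              ; a∉x = T-not⁻ a∉x ∘ ∈⇒∈ᵇ ; b∉x = T-not⁻ b∉x ∘ ∈⇒∈ᵇ ; edge = e }

  IsRAdjacent⇒adjR : ∀ {Ψ x a b} → IsRAdjacent Ψ x a b → T (adjR Ψ x a b)
  IsRAdjacent⇒adjR r = T-∧⁺ (∈⇒∈ᵇ a∈R) (T-∧⁺ (∈⇒∈ᵇ b∈R) (T-∧⁺ (≢⇒≠ᶠ a≢b)
    (T-∧⁺ (T-not⁺ (a∉x ∘ ∈ᵇ⇒∈)) (T-∧⁺ (T-not⁺ (b∉x ∘ ∈ᵇ⇒∈)) edge))))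
    where open IsRAdjacent r

  -- The first step of a path in R_u leaves from a vertex outside u.
  pathCount-from-root : ∀ (Ψ : Constellation m) u ℓ {y} z → y ∈ u → pathCount Ψ u (suc ℓ) y z ≡ 0
  pathCount-from-root Ψ u ℓ {y} z y∈u = count-never noPath (vectors (suc (suc ℓ)))
    where
    noPath : ∀ w → ¬ T (isPath (adjR Ψ u) (suc ℓ) y z w)
    noPath w@(a ∷ b ∷ _) t = IsRAdjacent.a∉x first (subst (_∈ u) (sym head≡) y∈u)
      where
      open IsPath (isPath⇒IsPath w t)
      first : IsRAdjacent Ψ u a b
      first = adjR⇒IsRAdjacent Ψ u a b (proj₁ (T-∧⁻ {adjR Ψ u a b} steps))

module _ {m : ℕ} (Ψ : Constellation m) where

  degree-as-pairs : ∀ u → degree Ψ u ≡ count (λ g → E Ψ (g ∪ u) ∧ disjᵇ g u) (allSubsets m)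
  degree-as-pairs u = count-⊇-shift u (E Ψ)

  module _ {k : ℕ} (uniform : IsUniformConstellation k Ψ) (2≤k : 2 ≤ k) (u : Subset m) (∣u∣ : ∣ u ∣ ≡ k ∸ 2) where

    link-pair : ∀ {g} → T (E Ψ (g ∪ u)) → Disjoint g u → g ⊆ V Ψ × ∣ g ∣ ≡ 2
    link-pair {g} edge g#u = (λ i∈g → proj₁ (proj₁ uniform (g ∪ u) edge) (x∈p∪q⁺ (inj₁ i∈g))) , ∣g∣≡2
      where
      ∣g∣≡2 : ∣ g ∣ ≡ 2
      ∣g∣≡2 = ℕₚ.+-cancelʳ-≡ (k ∸ 2) ∣ g ∣ 2 (begin
        ∣ g ∣ + (k ∸ 2)  ≡⟨ cong (∣ g ∣ +_) (sym ∣u∣) ⟩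
        ∣ g ∣ + ∣ u ∣    ≡⟨ sym (∣p∪q∣≡∣p∣+∣q∣ g u g#u) ⟩
        ∣ g ∪ u ∣        ≡⟨ proj₂ (proj₁ uniform (g ∪ u) edge) ⟩
        k                ≡⟨ sym (ℕₚ.m∸n+n≡m 2≤k) ⟩
        (k ∸ 2) + 2      ≡⟨ ℕₚ.+-comm (k ∸ 2) 2 ⟩
        2 + (k ∸ 2)      ∎)
        where open ≡-Reasoning

    2*degree+n≤n² : 2 * degree Ψ u + ∣ V Ψ ∣ ≤ ∣ V Ψ ∣ * ∣ V Ψ ∣
    2*degree+n≤n² = ≤-trans (+-monoˡ-≤ ∣ V Ψ ∣ (*-monoʳ-≤ 2 degree≤)) (subsetsOfSize-2 (V Ψ))
      where
      pair : ∀ g → T (E Ψ (g ∪ u) ∧ disjᵇ g u) → T ((g ⊆ᵇ V Ψ) ∧ (∣ g ∣ ==ᵇ 2))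
      pair g t = let edge , g#u = T-∧⁻ {E Ψ (g ∪ u)} t
                     g⊆V , ∣g∣≡2 = link-pair edge (disjᵇ⇒Disjoint g#u)
                 in T-∧⁺ (⊆⇒⊆ᵇ g⊆V) (≡⇒==ᵇ ∣g∣≡2)
      degree≤ : degree Ψ u ≤ subsetsOfSize 2 (V Ψ)
      degree≤ = ≤-trans (≤-reflexive (degree-as-pairs u)) (count-mono pair (allSubsets m))

-- R_u has a second vertex z, and a vertex of R_u ∩ u would start no path to z.
R-avoids-root : ∀ {m k α β ℓ μ} {Ψ : Constellation m} → IsABLMConstellation k α β (suc ℓ) μ Ψ →
  0ℚ ℚ.≤ α → Positive β → 12 ≤ ∣ V Ψ ∣ → ∀ u → u ⊆ V Ψ → ∣ u ∣ ≡ k ∸ 2 → Disjoint (R Ψ u) u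
R-avoids-root {α = α} {β} {ℓ} {Ψ = Ψ} (_ , (_ , radius) , paths) 0≤α β>0 12≤n u u⊆V ∣u∣ {i} i∈R i∈u =
  let z , z∈R , z≢i = ∃-other-element {p = R Ψ u} i (radius≥2 α ∣ V Ψ ∣ ∣ R Ψ u ∣ 0≤α 12≤n (proj₁ (radius u u⊆V ∣u∣)))
  in ¬*toℚ≤0 β (∣ V Ψ ∣ ^ ℓ) β>0 (ℕₚ.m^n>0 ∣ V Ψ ∣ {{>-nonZero (≤-trans (s≤s z≤n) 12≤n)}} ℓ)
       (subst (λ c → β ℚ.* toℚ (∣ V Ψ ∣ ^ ℓ) ℚ.≤ toℚ c) (pathCount-from-root Ψ u ℓ z i∈u)
              (paths u u⊆V ∣u∣ i z i∈R z∈R (z≢i ∘ sym)))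

-- The constellation Ψ_S - X

module LinkDelete {m : ℕ} (Ψ : Constellation m) (S X : Subset m) where

  Ψ′ : Constellation m
  Ψ′ = deleteC X (linkC S Ψ)

  Kept : Fin m → Set
  Kept i = i ∈ V Ψ × i ∉ S × i ∉ X

  private
    kept⁺ : ∀ {i} → Kept i → i ∈ (V Ψ ─ S) ─ X
    kept⁺ (i∈V , i∉S , i∉X) = x∈p∧x∉q⇒x∈p─q (x∈p∧x∉q⇒x∈p─q i∈V i∉S) i∉X

    kept⁻ : ∀ {i} → i ∈ (V Ψ ─ S) ─ X → Kept i
    kept⁻ i∈ = let i∈V─S , i∉X = x∈p─q⁻ (V Ψ ─ S) X i∈
                   i∈V , i∉S = x∈p─q⁻ (V Ψ) S i∈V─S
               in i∈V , i∉S , i∉X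

    kept⇒∈V─S : ∀ {i} → Kept i → i ∈ V Ψ ─ S
    kept⇒∈V─S = proj₁ ∘ x∈p─q⁻ (V Ψ ─ S) X ∘ kept⁺

  ∈V′⁺ : ∀ {i} → Kept i → i ∈ V Ψ′
  ∈V′⁺ kept = x∈p∩q⁺ (kept⇒∈V─S kept , kept⁺ kept)

  ∈V′⁻ : ∀ {i} → i ∈ V Ψ′ → Kept i
  ∈V′⁻ i∈V′ = kept⁻ (proj₂ (x∈p∩q⁻ (V Ψ ─ S) ((V Ψ ─ S) ─ X) i∈V′))

  edge′⁻ : ∀ {f} → T (E Ψ′ f) → f ⊆ V Ψ′ × T (E Ψ (f ∪ S))
  edge′⁻ {f} t = let link , f⊆ = T-∧⁻ {(f ⊆ᵇ (V Ψ ─ S)) ∧ E Ψ (f ∪ S)} t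
                 in ∈V′⁺ ∘ kept⁻ ∘ ⊆ᵇ⇒⊆ f⊆ , proj₂ (T-∧⁻ {f ⊆ᵇ (V Ψ ─ S)} link)

  edge′⁺ : ∀ {f} → (∀ {i} → i ∈ f → Kept i) → T (E Ψ (f ∪ S)) → T (E Ψ′ f)
  edge′⁺ kept edge = T-∧⁺ (T-∧⁺ (⊆⇒⊆ᵇ (kept⇒∈V─S ∘ kept)) edge) (⊆⇒⊆ᵇ (kept⁺ ∘ kept))

  ∈R′⁻ : ∀ {x i} → i ∈ R Ψ′ x → i ∈ R Ψ (x ∪ S) × Kept i
  ∈R′⁻ {x} i∈R′ = let i∈R─S , i∈ = x∈p∩q⁻ (R Ψ (x ∪ S) ─ S) ((V Ψ ─ S) ─ X) i∈R′
                  in proj₁ (x∈p─q⁻ (R Ψ (x ∪ S)) S i∈R─S) , kept⁻ i∈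

  ∈R′⁺ : ∀ {x i} → i ∈ R Ψ (x ∪ S) → Kept i → i ∈ R Ψ′ x
  ∈R′⁺ i∈R kept@(_ , i∉S , _) = x∈p∩q⁺ (x∈p∧x∉q⇒x∈p─q i∈R i∉S , kept⁺ kept)

  uniform : ∀ {k} → IsUniformConstellation k Ψ → IsUniformConstellation (k ∸ ∣ S ∣) Ψ′
  uniform {k} (edges , _) = edges′ , λ x _ _ i∈R′ → ∈V′⁺ (proj₂ (∈R′⁻ i∈R′))
    where
    edges′ : ∀ f → T (E Ψ′ f) → f ⊆ V Ψ′ × ∣ f ∣ ≡ k ∸ ∣ S ∣
    edges′ f t = f⊆V′ , (begin
      ∣ f ∣                     ≡⟨ sym (ℕₚ.m+n∸n≡m ∣ f ∣ ∣ S ∣) ⟩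
      ∣ f ∣ + ∣ S ∣ ∸ ∣ S ∣      ≡⟨ cong (_∸ ∣ S ∣) (sym (∣p∪q∣≡∣p∣+∣q∣ f S f#S)) ⟩
      ∣ f ∪ S ∣ ∸ ∣ S ∣          ≡⟨ cong (_∸ ∣ S ∣) (proj₂ (edges (f ∪ S) edge)) ⟩
      k ∸ ∣ S ∣                 ∎)
      where
      open ≡-Reasoning
      f⊆V′ : f ⊆ V Ψ′
      f⊆V′ = proj₁ (edge′⁻ t)
      edge : T (E Ψ (f ∪ S))
      edge = proj₂ (edge′⁻ t)
      f#S : Disjoint f S
      f#S = proj₁ ∘ proj₂ ∘ ∈V′⁻ ∘ f⊆V′

  ∣V′∣≤∣V∣ : ∣ V Ψ′ ∣ ≤ ∣ V Ψ ∣
  ∣V′∣≤∣V∣ = p⊆q⇒∣p∣≤∣q∣ (proj₁ ∘ ∈V′⁻)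

  ∣V′∣+∣X∣≤∣V∣ : X ⊆ V Ψ → ∣ V Ψ′ ∣ + ∣ X ∣ ≤ ∣ V Ψ ∣
  ∣V′∣+∣X∣≤∣V∣ X⊆V = begin
    ∣ V Ψ′ ∣ + ∣ X ∣   ≡⟨ sym (∣p∪q∣≡∣p∣+∣q∣ (V Ψ′) X (proj₂ ∘ proj₂ ∘ ∈V′⁻)) ⟩
    ∣ V Ψ′ ∪ X ∣       ≤⟨ p⊆q⇒∣p∣≤∣q∣ (λ i∈ → [ proj₁ ∘ ∈V′⁻ , X⊆V ] (x∈p∪q⁻ (V Ψ′) X i∈)) ⟩
    ∣ V Ψ ∣            ∎
    where open ≤-Reasoning

  ∣V∣≤∣V′∣+∣S∣+∣X∣ : ∣ V Ψ ∣ ≤ ∣ V Ψ′ ∣ + ∣ S ∣ + ∣ X ∣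
  ∣V∣≤∣V′∣+∣S∣+∣X∣ = begin
    ∣ V Ψ ∣                   ≤⟨ p⊆q⇒∣p∣≤∣q∣ V⊆ ⟩
    ∣ (V Ψ′ ∪ S) ∪ X ∣        ≤⟨ ∣p∪q∣≤∣p∣+∣q∣ (V Ψ′ ∪ S) X ⟩
    ∣ V Ψ′ ∪ S ∣ + ∣ X ∣      ≤⟨ +-monoˡ-≤ ∣ X ∣ (∣p∪q∣≤∣p∣+∣q∣ (V Ψ′) S) ⟩
    ∣ V Ψ′ ∣ + ∣ S ∣ + ∣ X ∣  ∎
    where
    open ≤-Reasoning
    V⊆ : V Ψ ⊆ (V Ψ′ ∪ S) ∪ X
    V⊆ {i} i∈V with i ∈? S | i ∈? X
    ... | yes i∈S | _ = x∈p∪q⁺ (inj₁ (x∈p∪q⁺ (inj₂ i∈S)))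
    ... | no _ | yes i∈X = x∈p∪q⁺ (inj₂ i∈X)
    ... | no i∉S | no i∉X = x∈p∪q⁺ (inj₁ (x∈p∪q⁺ (inj₁ (∈V′⁺ (i∈V , i∉S , i∉X)))))

  crossEdges-linkDelete : ∀ x → crossEdges Ψ′ x ≤ crossEdges Ψ (x ∪ S)
  crossEdges-linkDelete x = count-mono cross (allSubsets m)
    where
    cross : ∀ f → T ((∣ f ∣ ==ᵇ 2) ∧ disjᵇ f x ∧ E Ψ′ (f ∪ x) ∧ (∣ f ∩ R Ψ′ x ∣ ==ᵇ 1)) →
                  T ((∣ f ∣ ==ᵇ 2) ∧ disjᵇ f (x ∪ S) ∧ E Ψ (f ∪ (x ∪ S)) ∧ (∣ f ∩ R Ψ (x ∪ S) ∣ ==ᵇ 1))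
    cross f t with T-∧⁻ {∣ f ∣ ==ᵇ 2} t
    ... | ∣f∣≡2 , t₁ with T-∧⁻ {disjᵇ f x} t₁
    ... | f#x , t₂ with T-∧⁻ {E Ψ′ (f ∪ x)} t₂
    ... | edge′ , one-in-R′ =
      T-∧⁺ {∣ f ∣ ==ᵇ 2} ∣f∣≡2 (T-∧⁺ {disjᵇ f (x ∪ S)} (Disjoint⇒disjᵇ f#u)
        (T-∧⁺ {E Ψ (f ∪ (x ∪ S))} (subst (T ∘ E Ψ) (∪-assoc f x S) (proj₂ (edge′⁻ edge′)))
              (subst (λ r → T (∣ r ∣ ==ᵇ 1)) (sym same-crossing) one-in-R′)))
      where
      kept : ∀ {i} → i ∈ f → Kept i
      kept i∈f = ∈V′⁻ (proj₁ (edge′⁻ edge′) (x∈p∪q⁺ (inj₁ i∈f)))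
      f#u : Disjoint f (x ∪ S)
      f#u i∈f i∈u = [ disjᵇ⇒Disjoint f#x i∈f , proj₁ (proj₂ (kept i∈f)) ] (x∈p∪q⁻ x S i∈u)
      same-crossing : f ∩ R Ψ (x ∪ S) ≡ f ∩ R Ψ′ x
      same-crossing = ⊆-antisym
        (λ i∈ → let i∈f , i∈R = x∈p∩q⁻ f (R Ψ (x ∪ S)) i∈ in x∈p∩q⁺ (i∈f , ∈R′⁺ i∈R (kept i∈f)))
        (λ i∈ → let i∈f , i∈R′ = x∈p∩q⁻ f (R Ψ′ x) i∈ in x∈p∩q⁺ (i∈f , proj₁ (∈R′⁻ i∈R′)))

  module _ {x : Subset m} (R⊆V : R Ψ (x ∪ S) ⊆ V Ψ) (R#S : Disjoint (R Ψ (x ∪ S)) S) where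

    kept-in-R : ∀ {i} → i ∈ R Ψ (x ∪ S) → i ∉ X → Kept i
    kept-in-R i∈R i∉X = R⊆V i∈R , R#S i∈R , i∉X

    ∣R∣-linkDelete : ∣ R Ψ (x ∪ S) ∣ ≤ ∣ R Ψ′ x ∣ + ∣ X ∣
    ∣R∣-linkDelete = ≤-trans (p⊆q⇒∣p∣≤∣q∣ R⊆R′∪X) (∣p∪q∣≤∣p∣+∣q∣ (R Ψ′ x) X)
      where
      R⊆R′∪X : R Ψ (x ∪ S) ⊆ R Ψ′ x ∪ X
      R⊆R′∪X {i} i∈R with i ∈? X
      ... | yes i∈X = x∈p∪q⁺ (inj₂ i∈X)
      ... | no i∉X = x∈p∪q⁺ (inj₁ (∈R′⁺ i∈R (kept-in-R i∈R i∉X)))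

  module _ {x : Subset m} (x⊆V′ : x ⊆ V Ψ′) where

    private
      u : Subset m
      u = x ∪ S

    x#S : Disjoint x S
    x#S = proj₁ ∘ proj₂ ∘ ∈V′⁻ ∘ x⊆V′

    x∪S⊆V : S ⊆ V Ψ → x ∪ S ⊆ V Ψ
    x∪S⊆V S⊆V i∈u = [ proj₁ ∘ ∈V′⁻ ∘ x⊆V′ , S⊆V ] (x∈p∪q⁻ x S i∈u)

    ∣x∪S∣ : ∀ k → ∣ S ∣ ≤ k ∸ 2 → ∣ x ∣ ≡ k ∸ ∣ S ∣ ∸ 2 → ∣ x ∪ S ∣ ≡ k ∸ 2
    ∣x∪S∣ k s≤k∸2 ∣x∣ = begin
      ∣ x ∪ S ∣                  ≡⟨ ∣p∪q∣≡∣p∣+∣q∣ x S x#S ⟩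
      ∣ x ∣ + s                  ≡⟨ cong (_+ s) ∣x∣ ⟩
      k ∸ s ∸ 2 + s              ≡⟨ cong (_+ s) (ℕₚ.∸-+-assoc k s 2) ⟩
      k ∸ (s + 2) + s            ≡⟨ cong (λ d → k ∸ d + s) (ℕₚ.+-comm s 2) ⟩
      k ∸ (2 + s) + s            ≡⟨ cong (_+ s) (sym (ℕₚ.∸-+-assoc k 2 s)) ⟩
      k ∸ 2 ∸ s + s              ≡⟨ ℕₚ.m∸n+n≡m s≤k∸2 ⟩
      k ∸ 2                      ∎
      where
      open ≡-Reasoning
      s : ℕ
      s = ∣ S ∣

    -- A pair completing u to an edge of Ψ either avoids X, and then completes x to an edge of Ψ′,
    -- or it is one of at most |X| |V| pairs meeting X.
    degree-linkDelete : ∀ {k} → IsUniformConstellation k Ψ → 2 ≤ k → ∣ u ∣ ≡ k ∸ 2 →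
      degree Ψ u ≤ degree Ψ′ x + ∣ X ∣ * ∣ V Ψ ∣
    degree-linkDelete uniform 2≤k ∣u∣ = begin
      degree Ψ u                                                     ≡⟨ degree-as-pairs Ψ u ⟩
      count (λ g → E Ψ (g ∪ u) ∧ disjᵇ g u) (allSubsets m)           ≤⟨ count-split keptOrMeeting (allSubsets m) ⟩
      count (λ g → E Ψ′ (g ∪ x) ∧ disjᵇ g x) (allSubsets m) + M      ≡⟨ cong (_+ M) (sym (degree-as-pairs Ψ′ x)) ⟩
      degree Ψ′ x + M                                                ≤⟨ +-monoʳ-≤ (degree Ψ′ x) M≤ ⟩
      degree Ψ′ x + ∣ X ∣ * ∣ V Ψ ∣                                  ∎
      where
      open ≤-Reasoning
      M : ℕ
      M = subsetsOfSizeMeeting 2 (V Ψ) X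
      M≤ : M ≤ ∣ X ∣ * ∣ V Ψ ∣
      M≤ = ≤-trans (subsetsOfSizeMeeting-2 (V Ψ) X) (*-monoˡ-≤ ∣ V Ψ ∣ (∣p∩q∣≤∣q∣ (V Ψ) X))
      keptOrMeeting : ∀ g → T (E Ψ (g ∪ u) ∧ disjᵇ g u) →
        T (E Ψ′ (g ∪ x) ∧ disjᵇ g x) ⊎ T ((g ⊆ᵇ V Ψ) ∧ (∣ g ∣ ==ᵇ 2) ∧ not (disjᵇ g X))
      keptOrMeeting g t with T-∧⁻ {E Ψ (g ∪ u)} t
      ... | edge , g#u′ with link-pair Ψ uniform 2≤k u ∣u∣ edge (disjᵇ⇒Disjoint g#u′) | disjᵇ g X in disjoint
      ... | g⊆V , ∣g∣≡2 | false = inj₂ (T-∧⁺ {g ⊆ᵇ V Ψ} (⊆⇒⊆ᵇ g⊆V) (T-∧⁺ {∣ g ∣ ==ᵇ 2} (≡⇒==ᵇ ∣g∣≡2) tt))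
      ... | g⊆V , _ | true = inj₁ (T-∧⁺ (edge′⁺ kept (subst (T ∘ E Ψ) (sym (∪-assoc g x S)) edge))
                                        (Disjoint⇒disjᵇ (λ i∈g i∈x → g#u i∈g (x∈p∪q⁺ (inj₁ i∈x)))))
        where
        g#u : Disjoint g u
        g#u = disjᵇ⇒Disjoint g#u′
        g#X : Disjoint g X
        g#X = disjᵇ⇒Disjoint (subst T (sym disjoint) tt)
        kept : ∀ {i} → i ∈ g ∪ x → Kept i
        kept i∈ = [ (λ i∈g → g⊆V i∈g , (λ i∈S → g#u i∈g (x∈p∪q⁺ (inj₂ i∈S))) , g#X i∈g) , ∈V′⁻ ∘ x⊆V′ ]
                    (x∈p∪q⁻ g x i∈)

  module _ {x : Subset m} (x⊆V′ : x ⊆ V Ψ′) (R⊆V : R Ψ (x ∪ S) ⊆ V Ψ) (R#S : Disjoint (R Ψ (x ∪ S)) S) where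

    private
      u : Subset m
      u = x ∪ S

    adjR-linkDelete : ∀ {a b} → a ∉ X → b ∉ X → T (adjR Ψ u a b) → T (adjR Ψ′ x a b)
    adjR-linkDelete {a} {b} a∉X b∉X t = IsRAdjacent⇒adjR {Ψ = Ψ′} (record
      { a∈R = ∈R′⁺ a∈R (kept-in-R R⊆V R#S a∈R a∉X)
      ; b∈R = ∈R′⁺ b∈R (kept-in-R R⊆V R#S b∈R b∉X)
      ; a≢b = a≢b
      ; a∉x = a∉x ∘ x∈p∪q⁺ ∘ inj₁
      ; b∉x = b∉x ∘ x∈p∪q⁺ ∘ inj₁
      ; edge = edge′⁺ kept (subst (T ∘ E Ψ) regroup edge) })
      where
      open IsRAdjacent (adjR⇒IsRAdjacent Ψ u a b t)
      ab : Subset m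
      ab = ⁅ a ⁆ ∪ ⁅ b ⁆
      regroup : u ∪ ab ≡ (x ∪ ab) ∪ S
      regroup = trans (∪-assoc x S ab) (trans (cong (x ∪_) (∪-comm S ab)) (sym (∪-assoc x ab S)))
      kept : ∀ {i} → i ∈ x ∪ ab → Kept i
      kept i∈ = [ ∈V′⁻ ∘ x⊆V′
                , (λ i∈ab → [ (λ i∈a → subst Kept (sym (x∈⁅y⁆⇒x≡y a i∈a)) (kept-in-R R⊆V R#S a∈R a∉X))
                            , (λ i∈b → subst Kept (sym (x∈⁅y⁆⇒x≡y b i∈b)) (kept-in-R R⊆V R#S b∈R b∉X)) ]
                            (x∈p∪q⁻ ⁅ a ⁆ ⁅ b ⁆ i∈ab)) ]
                (x∈p∪q⁻ x ab i∈)

    -- A path of R_u between vertices of R′_x either survives in R′_x or, after its first vertex,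
    -- is a sequence of vertices of V(Ψ) ending at z and meeting X.
    pathCount-linkDelete : ∀ ℓ {y z} → y ∈ R Ψ′ x → z ∈ R Ψ′ x →
      pathCount Ψ u (suc ℓ) y z
        ≤ pathCount Ψ′ x (suc ℓ) y z + count (λ w → endsAt (V Ψ) z w ∧ meets X w) (vectors (suc ℓ))
    pathCount-linkDelete ℓ {y} {z} y∈R′ z∈R′ = begin
      pathCount Ψ u (suc ℓ) y z                                ≤⟨ count-split survivesOrHits (vectors (suc (suc ℓ))) ⟩
      pathCount Ψ′ x (suc ℓ) y z + count hits (vectors (suc (suc ℓ)))
        ≡⟨ cong (pathCount Ψ′ x (suc ℓ) y z +_) (count-allVecs-suc (allFin m) (suc ℓ) (λ a → does (a ≟ y)) endsMeeting) ⟩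
      pathCount Ψ′ x (suc ℓ) y z + count (λ a → does (a ≟ y)) (allFin m) * c
        ≡⟨ cong (λ k → pathCount Ψ′ x (suc ℓ) y z + k * c) (count-≟ y) ⟩
      pathCount Ψ′ x (suc ℓ) y z + 1 * c                       ≡⟨ cong (pathCount Ψ′ x (suc ℓ) y z +_) (ℕₚ.*-identityˡ c) ⟩
      pathCount Ψ′ x (suc ℓ) y z + c                           ∎
      where
      open ≤-Reasoning
      endsMeeting : Vec (Fin m) (suc ℓ) → Bool
      endsMeeting v = endsAt (V Ψ) z v ∧ meets X v
      c : ℕ
      c = count endsMeeting (vectors (suc ℓ))
      hits : Vec (Fin m) (suc (suc ℓ)) → Bool
      hits w = does (Vec.head w ≟ y) ∧ endsMeeting (Vec.tail w)
      survivesOrHits : ∀ w → T (isPath (adjR Ψ u) (suc ℓ) y z w) → T (isPath (adjR Ψ′ x) (suc ℓ) y z w) ⊎ T (hits w)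
      survivesOrHits w@(a ∷ v@(_ ∷ _)) t with meets X v in meets≡
      ... | true = inj₂ (T-∧⁺ {does (a ≟ y)} (⇒does {d = a ≟ y} head≡) (T-∧⁺ {endsAt (V Ψ) z v} ends tt))
        where
        open IsPath (isPath⇒IsPath w t)
        v⊆R : All (_∈ R Ψ u) v
        v⊆R = consecutive-targets (λ {a} {b} ab → IsRAdjacent.b∈R (adjR⇒IsRAdjacent Ψ u a b ab)) a v steps
        ends : T (endsAt (V Ψ) z v)
        ends = T-∧⁺ {allIn (V Ψ) v} (All⇒allIn v (All.map R⊆V v⊆R)) (⇒does {d = Vec.last v ≟ z} last≡)
      ... | false = inj₁ (IsPath⇒isPath w (record
                      { head≡ = head≡ ; last≡ = last≡ ; distinct = distinct
                      ; steps = consecutive-mono adjR-linkDelete w avoidsX steps }))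
        where
        open IsPath (isPath⇒IsPath w t)
        avoidsX : All (_∉ X) w
        avoidsX = subst (_∉ X) (sym head≡) (proj₂ (proj₂ (proj₂ (∈R′⁻ y∈R′))))
                ∷ ¬meets⇒All v (λ h → subst T meets≡ h)

-- n′ ≥ n - n/6 - n/9 = 13n/18, and (13/18)² > 1/2.
n²≤2n′² : ∀ n n′ s t → n ≤ n′ + s + t → 6 * s ≤ n → 9 * t ≤ n → n * n ≤ 2 * (n′ * n′)
n²≤2n′² n n′ s t n≤ 6s≤n 9t≤n = ℕₚ.*-cancelˡ-≤ 162 (begin
  162 * (n * n)            ≤⟨ *-monoˡ-≤ (n * n) (ℕₚ.m≤m+n 162 7) ⟩
  169 * (n * n)            ≡⟨ square 13 n ⟩
  (13 * n) * (13 * n)      ≤⟨ *-mono-≤ 13n≤18n′ 13n≤18n′ ⟩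
  (18 * n′) * (18 * n′)    ≡⟨ sym (square 18 n′) ⟩
  324 * (n′ * n′)          ≡⟨ ℕₚ.*-assoc 162 2 (n′ * n′) ⟩
  162 * (2 * (n′ * n′))    ∎)
  where
  open ≤-Reasoning
  square : ∀ c a → (c * c) * (a * a) ≡ (c * a) * (c * a)
  square = solve-∀
  13n≤18n′ : 13 * n ≤ 18 * n′
  13n≤18n′ = ℕₚ.+-cancelʳ-≤ (5 * n) (13 * n) (18 * n′) (begin
    13 * n + 5 * n                      ≡⟨ eighteen n ⟩
    18 * n                              ≤⟨ *-monoʳ-≤ 18 n≤ ⟩
    18 * (n′ + s + t)                   ≡⟨ spread n′ s t ⟩
    18 * n′ + (3 * (6 * s) + 2 * (9 * t)) ≤⟨ +-monoʳ-≤ (18 * n′) (+-mono-≤ (*-monoʳ-≤ 3 6s≤n) (*-monoʳ-≤ 2 9t≤n)) ⟩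
    18 * n′ + (3 * n + 2 * n)           ≡⟨ cong (18 * n′ +_) (five n) ⟩
    18 * n′ + 5 * n                     ∎)
    where
    eighteen : ∀ a → 13 * a + 5 * a ≡ 18 * a
    eighteen = solve-∀
    spread : ∀ a b c → 18 * (a + b + c) ≡ 18 * a + (3 * (6 * b) + 2 * (9 * c))
    spread = solve-∀
    five : ∀ a → 3 * a + 2 * a ≡ 5 * a
    five = solve-∀

module Thinned {m k : ℕ} {α β μ : ℚ} {j : ℕ} {Ψ : Constellation m} {S X : Subset m}
  (constellation : IsABLMConstellation k α β (suc (suc j)) μ Ψ)
  (2≤k : 2 ≤ k) (α>0 : Positive α) (β>0 : Positive β) (μ>0 : Positive μ) (6k≤n : 6 * k ≤ ∣ V Ψ ∣)
  (S⊆V : S ⊆ V Ψ) (X⊆V : X ⊆ V Ψ) (s≤k∸2 : ∣ S ∣ ≤ k ∸ 2)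
  (t≤ϑn : toℚ ∣ X ∣ ℚ.≤ ϑ α β (suc (suc j)) ℚ.* toℚ ∣ V Ψ ∣) where

  open LinkDelete Ψ S X

  private
    uniformΨ : IsUniformConstellation k Ψ
    uniformΨ = proj₁ constellation

    codegree : ∀ u → u ⊆ V Ψ → ∣ u ∣ ≡ k ∸ 2 →
      (fiveNinths ℚ.+ α) ℚ.* toℚ (∣ V Ψ ∣ * ∣ V Ψ ∣) ℚ.* ½ ℚ.≤ toℚ (degree Ψ u)
    codegree = proj₁ (proj₁ (proj₂ constellation))

    radius : ∀ u → u ⊆ V Ψ → ∣ u ∣ ≡ k ∸ 2 →
      ((twoThirds ℚ.+ α ℚ.* ½) ℚ.* toℚ ∣ V Ψ ∣ ℚ.≤ toℚ ∣ R Ψ u ∣) ×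
      (toℚ (crossEdges Ψ u) ℚ.≤ μ ℚ.* toℚ (∣ V Ψ ∣ * ∣ V Ψ ∣))
    radius = proj₂ (proj₁ (proj₂ constellation))

    paths : ∀ u → u ⊆ V Ψ → ∣ u ∣ ≡ k ∸ 2 → ∀ y z → y ∈ R Ψ u → z ∈ R Ψ u → y ≢ z →
      β ℚ.* toℚ (∣ V Ψ ∣ ^ suc j) ℚ.≤ toℚ (pathCount Ψ u (suc (suc j)) y z)
    paths = proj₂ (proj₂ constellation)

    0≤ : ∀ q → Positive q → 0ℚ ℚ.≤ q
    0≤ q q>0 = ℚₚ.<⇒≤ (ℚₚ.positive⁻¹ q {{q>0}})

    12≤n : 12 ≤ ∣ V Ψ ∣
    12≤n = ≤-trans (*-monoʳ-≤ 6 2≤k) 6k≤n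

    6s≤n : 6 * ∣ S ∣ ≤ ∣ V Ψ ∣
    6s≤n = ≤-trans (*-monoʳ-≤ 6 (≤-trans s≤k∸2 (ℕₚ.m∸n≤m k 2))) 6k≤n

    4t≤αn : toℚ (4 * ∣ X ∣) ℚ.≤ α ℚ.* toℚ ∣ V Ψ ∣
    4t≤αn = ϑ-bound-α α β (suc (suc j)) (∣ X ∣) (∣ V Ψ ∣) t≤ϑn

  module Root {x : Subset m} (x⊆V′ : x ⊆ V Ψ′) (∣x∣ : ∣ x ∣ ≡ k ∸ ∣ S ∣ ∸ 2) where

    private
      u : Subset m
      u = x ∪ S

      u⊆V : u ⊆ V Ψ
      u⊆V = x∪S⊆V x⊆V′ S⊆V

      ∣u∣ : ∣ u ∣ ≡ k ∸ 2
      ∣u∣ = ∣x∪S∣ x⊆V′ k s≤k∸2 ∣x∣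

      R⊆V : R Ψ u ⊆ V Ψ
      R⊆V = proj₂ uniformΨ u u⊆V ∣u∣

      R#S : Disjoint (R Ψ u) S
      R#S i∈R i∈S = R-avoids-root {k = k} {α} {β} {suc j} {μ} constellation (0≤ α α>0) β>0 12≤n u u⊆V ∣u∣ i∈R
                      (x∈p∪q⁺ (inj₂ i∈S))

      9t≤n : 9 * ∣ X ∣ ≤ ∣ V Ψ ∣
      9t≤n = deleted-ninth α (∣ V Ψ ∣) (degree Ψ u) (∣ X ∣) (≤-trans (s≤s z≤n) 12≤n) (codegree u u⊆V ∣u∣)
                           (2*degree+n≤n² Ψ uniformΨ 2≤k u ∣u∣) 4t≤αn

    codegree′ : (fiveNinths ℚ.+ α ℚ.* ½) ℚ.* toℚ (∣ V Ψ′ ∣ * ∣ V Ψ′ ∣) ℚ.* ½ ℚ.≤ toℚ (degree Ψ′ x)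
    codegree′ = codegree-inequality α (∣ V Ψ ∣) (∣ V Ψ′ ∣) (degree Ψ u) (degree Ψ′ x) (∣ X ∣) (0≤ α α>0) (codegree u u⊆V ∣u∣)
                  (degree-linkDelete x⊆V′ uniformΨ 2≤k ∣u∣) 4t≤αn ∣V′∣≤∣V∣

    radius′ : (twoThirds ℚ.+ α ℚ.* ½ ℚ.* ½) ℚ.* toℚ ∣ V Ψ′ ∣ ℚ.≤ toℚ ∣ R Ψ′ x ∣
    radius′ = radius-inequality α (∣ V Ψ ∣) (∣ V Ψ′ ∣) (∣ X ∣) (∣ R Ψ u ∣) (∣ R Ψ′ x ∣) (0≤ α α>0) (proj₁ (radius u u⊆V ∣u∣))
                (∣R∣-linkDelete R⊆V R#S) (∣V′∣+∣X∣≤∣V∣ X⊆V) 4t≤αn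

    crossing′ : toℚ (crossEdges Ψ′ x) ℚ.≤ toℚ 2 ℚ.* μ ℚ.* toℚ (∣ V Ψ′ ∣ * ∣ V Ψ′ ∣)
    crossing′ = crossing-inequality μ (∣ V Ψ ∣) (∣ V Ψ′ ∣) (crossEdges Ψ u) (crossEdges Ψ′ x) (0≤ μ μ>0)
                  (crossEdges-linkDelete x) (proj₂ (radius u u⊆V ∣u∣))
                  (n²≤2n′² (∣ V Ψ ∣) (∣ V Ψ′ ∣) (∣ S ∣) (∣ X ∣) ∣V∣≤∣V′∣+∣S∣+∣X∣ 6s≤n 9t≤n)

    paths′ : ∀ {y z} → y ∈ R Ψ′ x → z ∈ R Ψ′ x → y ≢ z →
      β ℚ.* ½ ℚ.* toℚ (∣ V Ψ′ ∣ ^ suc j) ℚ.≤ toℚ (pathCount Ψ′ x (suc (suc j)) y z)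
    paths′ {y} {z} y∈R′ z∈R′ y≢z =
      path-inequality β j (∣ V Ψ ∣) (∣ V Ψ′ ∣) (∣ X ∣)
        (pathCount Ψ u (suc (suc j)) y z) (pathCount Ψ′ x (suc (suc j)) y z) _ (0≤ β β>0)
        (paths u u⊆V ∣u∣ y z (proj₁ (∈R′⁻ y∈R′)) (proj₁ (∈R′⁻ z∈R′)) y≢z)
        (pathCount-linkDelete x⊆V′ R⊆V R#S (suc j) y∈R′ z∈R′)
        meeting-X
        (ϑ-bound-β α β (suc j) (∣ X ∣) (∣ V Ψ ∣) t≤ϑn) ∣V′∣≤∣V∣
      where
      meeting-X : count (λ w → endsAt (V Ψ) z w ∧ meets X w) (vectors (suc (suc j))) ≤ suc j * ∣ X ∣ * ∣ V Ψ ∣ ^ j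
      meeting-X = ≤-trans (count-endsAt-meets j (V Ψ) X z (proj₂ (proj₂ (proj₂ (∈R′⁻ z∈R′)))))
                          (*-monoˡ-≤ (∣ V Ψ ∣ ^ j) (*-monoʳ-≤ (suc j) (∣p∩q∣≤∣q∣ (V Ψ) X)))

lemma2p35 : (k : ℕ) → 2 ≤ k → (α β μ : ℚ) → Positive α → Positive β → Positive μ →
    (ℓ : ℕ) → ¬ (2 divides ℓ) → 3 ≤ ℓ →
    (m : ℕ) (Ψ : Constellation m) → IsABLMConstellation k α β ℓ μ Ψ →
    6 * k ≤ ∣ V Ψ ∣ →
    (S X : Subset m) → S ⊆ V Ψ → X ⊆ V Ψ → Empty (S ∩ X) → ∣ S ∣ ≤ k ∸ 2 →
    toℚ ∣ X ∣ ℚ.≤ ϑ α β ℓ ℚ.* toℚ ∣ V Ψ ∣ →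
    IsABLMConstellation (k ∸ ∣ S ∣) (α ℚ.* ½) (β ℚ.* ½) ℓ (toℚ 2 ℚ.* μ)
      (deleteC X (linkC S Ψ))
lemma2p35 k 2≤k α β μ α>0 β>0 μ>0 ℓ _ (s≤s (s≤s {n = j} _)) m Ψ constellation 6k≤n S X S⊆V X⊆V _ s≤k∸2 t≤ϑn =
  LinkDelete.uniform Ψ S X (proj₁ constellation) ,
  ((λ x x⊆V′ ∣x∣ → codegree′ x⊆V′ ∣x∣) , (λ x x⊆V′ ∣x∣ → radius′ x⊆V′ ∣x∣ , crossing′ x⊆V′ ∣x∣)) ,
  (λ x x⊆V′ ∣x∣ y z → paths′ x⊆V′ ∣x∣)
  where
  open Thinned {k = k} {α} {β} {μ} {j} {Ψ} {S} {X} constellation 2≤k α>0 β>0 μ>0 6k≤n S⊆V X⊆V s≤k∸2 t≤ϑn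
  open Root
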